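{- Let $R$ be a commutative Frobenius ring with unity and with a fixed non-trivial involutory ring automorphism $x\mapsto\overline{x}$. Let $n\in\mathbb{N}$, let $\lambda,\mu\in R$ satisfy $\lambda\overline{\lambda}=\mu\overline{\mu}=1$, let $\mathbf{a},\mathbf{b},\mathbf{c}\in R^n$, and put $A=\mathrm{circ}_\lambda(\mathbf{a})$, $B=\mathrm{circ}_\lambda(\mathbf{b})$, $C=\mathrm{circ}_\mu(\mathbf{c})$, $J=J_n$. Let $$G=\begin{pmatrix} I_{2n} & X\end{pmatrix},\qquad X=\begin{pmatrix} -A^TCJ & -\overline{B}\\ B^TCJ & -\overline{A}\end{pmatrix}.$$ Then $G$ is a generator matrix of a Hermitian self-dual $[4n,2n]$-code over $R$ (i.e. the $R$-submodule of $R^{4n}$ generated by the rows of $G$ is Hermitian self-dual) if and only if $$\Theta(\mathbf{a},\overline{\mathbf{a}},j)[\overline{\lambda}]+\Theta(\mathbf{b},\overline{\mathbf{b}},j)[\overline{\lambda}]=\begin{cases}-1,& j=0,\\ 0,& j\in\{1,\dots,\lfloor n/2\rfloor\},\end{cases}$$ and $$\Theta(\mathbf{c},\overline{\mathbf{c}},j)[\overline{\mu}]=\begin{cases}1,& j=0,\\ 0,& j\in\{1,\dots,\lfloor n/2\rfloor\}.\end{cases}$$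
   Context: For a matrix $M$ over $R$, $\overline{M}$ denotes entrywise application of the involution. For $\nu\in R$ and $\mathbf{v}=(v_0,\dots,v_{n-1})\in R^n$, $\mathrm{circ}_\nu(\mathbf{v})$ is the $n\times n$ $\nu$-circulant matrix whose first row is $\mathbf{v}$ and each subsequent row is the previous row shifted cyclically one place to the right, with the entry wrapped around to the first position multiplied by $\nu$; i.e. $\mathrm{circ}_\nu(\mathbf{v})=\sum_{i=0}^{n-1}v_iP_\nu^i$ with $P_\nu=\begin{pmatrix}\mathbf{0}& I_{n-1}\\ \nu & \mathbf{0}\end{pmatrix}$. $J_n$ is the $n\times n$ exchange matrix (entry $(i,j)$ equals $1$ if $i+j=n+1$ and $0$ otherwise). For $\mathbf{x},\mathbf{y}\in R^n$ and $\mathbf{x}=(x_0,\dots,x_{n-1})$, $\mathbf{y}=(y_0,\dots,y_{n-1})$, $j\in\{0,\dots,n-1\}$ and $\nu\in R$: $\Theta(\mathbf{x},\mathbf{y},j)[\nu]=\sum_{i=0}^{n-j-1}x_{[i+j]_n}y_i+\nu\sum_{i=n-j}^{n-1}x_{[i+j]_n}y_i$, where $[m]_n\in\{0,\dots,n-1\}$ is the residue of $m$ modulo $n$; for $j=0$ this is $\sum_i x_iy_i$. The Hermitian inner product on $R^N$ is $\langle\mathbf{x},\mathbf{y}\rangle_H=\sum_i x_i\overline{y_i}$, the Hermitian dual of a code $\mathcal{C}\subseteq R^N$ is $\mathcal{C}^{\perp_H}=\{\mathbf{x}:\langle\mathbf{x},\mathbf{y}\rangle_H=0\ \forall\mathbf{y}\in\mathcal{C}\}$,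 and $\mathcal{C}$ is Hermitian self-dual if $\mathcal{C}=\mathcal{C}^{\perp_H}$. -}

module Defs where

open import Level using (Level; _⊔_) renaming (suc to lsuc)
open import Algebra.Bundles using (CommutativeRing)
open import Data.Nat as ℕ using (ℕ; zero; suc; _∸_; _≤_; _<_; _⊓_)
open import Data.Nat.DivMod using (_mod_)
open import Data.Fin as Fin using (Fin; toℕ; splitAt)
open import Data.Sum using (_⊎_; inj₁; inj₂)
open import Data.Product using (Σ; ∃; _×_; _,_)
open import Data.List using (List; []; _∷_; foldr; map)
open import Data.List.Relation.Unary.All using (All)
open import Data.List.Membership.Setoid using ()
open import Relation.Nullary using (¬_; does)
open import Relation.Unary using (Pred)
open import Data.Bool using (if_then_else_)

module _ {c ℓ : Level} (R : CommutativeRing c ℓ) where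
  open CommutativeRing R

  record IsIdeal (I : Pred Carrier (c ⊔ ℓ)) : Set (c ⊔ ℓ) where
    field
      resp  : ∀ {x y} → x ≈ y → I x → I y
      zero∈ : I 0#
      +-closed : ∀ {x y} → I x → I y → I (x + y)
      neg-closed : ∀ {x} → I x → I (- x)
      *-closed : ∀ r {x} → I x → I (r * x)

  IsMaximalIdeal : Pred Carrier (c ⊔ ℓ) → Set (lsuc (c ⊔ ℓ))
  IsMaximalIdeal M =
    IsIdeal M × ¬ M 1# ×
    (∀ (K : Pred Carrier (c ⊔ ℓ)) → IsIdeal K → (∀ x → M x → K x) →
       (∀ x → K x → M x) ⊎ (∀ x → K x))

  IsMinimalIdeal : Pred Carrier (c ⊔ ℓ) → Set (lsuc (c ⊔ ℓ))
  IsMinimalIdeal I =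
    IsIdeal I × (∃ λ x → I x × ¬ x ≈ 0#) ×
    (∀ (K : Pred Carrier (c ⊔ ℓ)) → IsIdeal K → (∀ x → K x → I x) →
       (∀ x → K x → x ≈ 0#) ⊎ (∀ x → I x → K x))

  Jac : Carrier → Set (lsuc (c ⊔ ℓ))
  Jac x = ∀ (M : Pred Carrier (c ⊔ ℓ)) → IsMaximalIdeal M → M x

  Soc : Carrier → Set (lsuc (c ⊔ ℓ))
  Soc x = ∃ λ (xs : List Carrier) →
            All (λ y → ∃ λ (I : Pred Carrier (c ⊔ ℓ)) → IsMinimalIdeal I × I y) xs ×
            x ≈ foldr _+_ 0# xs

  IsFinite : Set (c ⊔ ℓ)
  IsFinite = ∃ λ (xs : List Carrier) → ∀ x → Data.List.Membership.Setoid._∈_ setoid x xs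

  -- Frobenius: finite, and R/J(R) ≅ soc(R) as R-modules, i.e. there is an
  -- R-linear map φ : R → R with kernel J(R) and image soc(R).
  IsFrobenius : Set (lsuc (c ⊔ ℓ))
  IsFrobenius = IsFinite ×
    (∃ λ (φ : Carrier → Carrier) →
       (∀ {x y} → x ≈ y → φ x ≈ φ y) ×
       (∀ x y → φ (x + y) ≈ φ x + φ y) ×
       (∀ r x → φ (r * x) ≈ r * φ x) ×
       (∀ x → φ x ≈ 0# → Jac x) × (∀ x → Jac x → φ x ≈ 0#) ×
       (∀ y → Soc y → ∃ λ x → φ x ≈ y) × (∀ x → Soc (φ x)))

  record Involution : Set (c ⊔ ℓ) where
    field
      bar : Carrier → Carrier
      bar-cong : ∀ {x y} → x ≈ y → bar x ≈ bar y
      bar-+ : ∀ x y → bar (x + y) ≈ bar x + bar y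
      bar-* : ∀ x y → bar (x * y) ≈ bar x * bar y
      bar-1 : bar 1# ≈ 1#
      bar-invol : ∀ x → bar (bar x) ≈ x
      nontrivial : ∃ λ x → ¬ bar x ≈ x

  Σ[_] : ∀ {n} → (Fin n → Carrier) → Carrier
  Σ[_] {zero} f = 0#
  Σ[_] {suc n} f = f Fin.zero + Σ[ (λ i → f (Fin.suc i)) ]

  ΣRange : ℕ → ℕ → (ℕ → Carrier) → Carrier
  ΣRange from zero f = 0#
  ΣRange from (suc len) f = f from + ΣRange (suc from) len f

  Vect : ℕ → Set c
  Vect n = Fin n → Carrier

  Mat : ℕ → ℕ → Set c
  Mat m n = Fin m → Fin n → Carrier

  at : ∀ {n} → Vect n → ℕ → Carrier
  at {zero} x m = 0#
  at {suc n} x m = x (m mod suc n)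

  _·_ : ∀ {m k n} → Mat m k → Mat k n → Mat m n
  (A · B) i j = Σ[ (λ l → A i l * B l j) ]

  _ᵀ : ∀ {m n} → Mat m n → Mat n m
  (A ᵀ) i j = A j i

  negM : ∀ {m n} → Mat m n → Mat m n
  negM A i j = - A i j

  conjM : Involution → ∀ {m n} → Mat m n → Mat m n
  conjM ι A i j = Involution.bar ι (A i j)

  conjV : Involution → ∀ {n} → Vect n → Vect n
  conjV ι v i = Involution.bar ι (v i)

  δ : ℕ → ℕ → Carrier
  δ i j = if does (i ℕ.≟ j) then 1# else 0#

  Iₙ : ∀ n → Mat n n
  Iₙ n i j = δ (toℕ i) (toℕ j)

  Jₙ : ∀ n → Mat n n
  Jₙ n i j = δ (toℕ i ℕ.+ toℕ j) (n ∸ 1)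

  -- P_ν = [[0, I_{n-1}], [ν, 0]]  (0-indexed: P i (i+1) = 1, P (n-1) 0 = ν)
  Pν : ∀ n → Carrier → Mat n n
  Pν n ν i j =
    if does (suc (toℕ i) ℕ.≟ n)
    then (if does (toℕ j ℕ.≟ 0) then ν else 0#)
    else δ (suc (toℕ i)) (toℕ j)

  matPow : ∀ {n} → Mat n n → ℕ → Mat n n
  matPow {n} A zero = Iₙ n
  matPow {n} A (suc k) = matPow A k · A

  circ : ∀ {n} → Carrier → Vect n → Mat n n
  circ {n} ν v r s = Σ[ (λ i → v i * matPow (Pν n ν) (toℕ i) r s) ]

  block : ∀ {m₁ m₂ n₁ n₂} → Mat m₁ n₁ → Mat m₁ n₂ → Mat m₂ n₁ → Mat m₂ n₂ →
          Mat (m₁ ℕ.+ m₂) (n₁ ℕ.+ n₂)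
  block {m₁} {m₂} {n₁} {n₂} A B C D i j with splitAt m₁ i | splitAt n₁ j
  ... | inj₁ i' | inj₁ j' = A i' j'
  ... | inj₁ i' | inj₂ j' = B i' j'
  ... | inj₂ i' | inj₁ j' = C i' j'
  ... | inj₂ i' | inj₂ j' = D i' j'

  hcat : ∀ {m n₁ n₂} → Mat m n₁ → Mat m n₂ → Mat m (n₁ ℕ.+ n₂)
  hcat {m} {n₁} A B i j with splitAt n₁ j
  ... | inj₁ j' = A i j'
  ... | inj₂ j' = B i j'

  RowSpace : ∀ {k N} → Mat k N → Vect N → Set (c ⊔ ℓ)
  RowSpace G x = ∃ λ (u : Vect _) → ∀ j → x j ≈ Σ[ (λ i → u i * G i j) ]

  ⟨_,_⟩H[_] : ∀ {N} → Vect N → Vect N → Involution → Carrier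
  ⟨ x , y ⟩H[ ι ] = Σ[ (λ i → x i * Involution.bar ι (y i)) ]

  HermDual : Involution → ∀ {N} → (Vect N → Set (c ⊔ ℓ)) → Vect N → Set (c ⊔ ℓ)
  HermDual ι C x = ∀ y → C y → ⟨ x , y ⟩H[ ι ] ≈ 0#

  IsHermitianSelfDual : Involution → ∀ {N} → (Vect N → Set (c ⊔ ℓ)) → Set (c ⊔ ℓ)
  IsHermitianSelfDual ι C = (∀ x → C x → HermDual ι C x) × (∀ x → HermDual ι C x → C x)

  Θ : ∀ {n} → Vect n → Vect n → ℕ → Carrier → Carrier
  Θ {n} x y j ν =
    ΣRange 0 (n ∸ j) (λ i → at x (i ℕ.+ j) * at y i)
    + ν * ΣRange (n ∸ j) j (λ i → at x (i ℕ.+ j) * at y i)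

  Gmat : Involution → ∀ n → Carrier → Carrier → Vect n → Vect n → Vect n →
         Mat (n ℕ.+ n) ((n ℕ.+ n) ℕ.+ (n ℕ.+ n))
  Gmat ι n λ' μ a b c' =
    let A = circ λ' a ; B = circ λ' b ; C = circ μ c' ; J = Jₙ n
        X = block (negM (((A ᵀ) · C) · J)) (negM (conjM ι B))
                  (((B ᵀ) · C) · J)        (negM (conjM ι A))
    in hcat (Iₙ (n ℕ.+ n)) X

-- Write the generator as G = (I | X). Its row space is Hermitian self-dual iff
-- X Xᴴ = Xᴴ X = −I: orthogonality of the rows of G is the first identity, and the
-- vectors (−e Xᴴ, e), which are orthogonal to every row, lie in the code only if the
-- second holds.
-- A matrix commuting with the λ-shift P is the λ-circulant of its first row, so
-- A, B, Aᴴ, Bᴴ commute pairwise, and the two identities reduce to A Aᴴ + B Bᴴ = −I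
-- and C Cᴴ = I. Both left-hand sides are Hermitian and commute with their shift, so
-- they are scalar iff their first row is; that first row is given by Θ, and Hermitian
-- symmetry ties its entry j to entry n − j, so only 1 ≤ j ≤ n/2 needs checking.

module Submission where

open import Defs
open import Level using (_⊔_)
open import Algebra.Bundles using (CommutativeRing)
import Algebra.Properties.Ring as RingProperties
import Algebra.Properties.Semiring.Sum as SemiringSum
open import Data.Nat as ℕ using (ℕ; zero; suc; _∸_; _≤_; _<_; z≤n; s≤s; _/_)
import Data.Nat.Properties as ℕ
open import Data.Fin as Fin using (Fin; toℕ; fromℕ<; _↑ˡ_; _↑ʳ_; splitAt)
import Data.Fin.Properties as Fin
open import Data.Product using (_×_; _,_; proj₁; proj₂)
open import Data.Sum using (inj₁; inj₂)
open import Function using (_∘_)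
open import Data.Nat.DivMod using (_%_; m/n<m; m≡m%n+[m/n]*n; m%n<n)
open import Data.Bool using (true; false; if_then_else_)
open import Function.Bundles using (_⇔_; mk⇔; Equivalence)
open import Function.Properties.Equivalence using () renaming (trans to ⇔-trans)
open import Data.Product.Function.NonDependent.Propositional using (_×-⇔_)
open import Relation.Binary.Bundles using (Setoid)
import Relation.Binary.Reasoning.Setoid
open import Relation.Binary.PropositionalEquality as ≡ using (_≡_; _≢_)
open import Relation.Nullary using (¬_; yes; no; does)
open import Data.Empty using (⊥-elim)

≤half⇒< : ∀ {N j} → 1 ≤ N → j ≤ N / 2 → j < N
≤half⇒< {suc N} _ j≤ = ℕ.≤-<-trans j≤ (m/n<m (suc N) 2 (s≤s (s≤s z≤n)))

≰half⇒∸≤half : ∀ {N t} → t < N → ¬ t ≤ N / 2 → N ∸ t ≤ N / 2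
≰half⇒∸≤half {N} {t} t<N t≰ = ℕ.m≤n+o⇒m∸n≤o N t (begin
  N                    ≡⟨ m≡m%n+[m/n]*n N 2 ⟩
  N % 2 ℕ.+ q ℕ.* 2    ≤⟨ ℕ.+-monoˡ-≤ (q ℕ.* 2) (ℕ.≤-pred (m%n<n N 2)) ⟩
  1 ℕ.+ q ℕ.* 2        ≡⟨ ≡.cong suc (≡.trans (ℕ.*-comm q 2) (≡.cong (q ℕ.+_) (ℕ.+-identityʳ q))) ⟩
  suc q ℕ.+ q          ≤⟨ ℕ.+-monoˡ-≤ q (ℕ.≰⇒> t≰) ⟩
  t ℕ.+ q              ∎)
  where
    q = N / 2
    open ℕ.≤-Reasoning

module Sums {c ℓ} (R : CommutativeRing c ℓ) where
  open CommutativeRing R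
  open SemiringSum semiring using (sum; sum-cong-≋; sum-cong-≗; sum-replicate-zero; ∑-distrib-+; ∑-comm; *-distribˡ-sum)
  open import Relation.Binary.Reasoning.Setoid setoid

  module ≈-Reasoning = Relation.Binary.Reasoning.Setoid setoid

  ∑ : ∀ {n} → (Fin n → Carrier) → Carrier
  ∑ = Σ[_] R

  ∑≡sum : ∀ {n} (f : Fin n → Carrier) → ∑ f ≡ sum f
  ∑≡sum {zero} f = ≡.refl
  ∑≡sum {suc n} f = ≡.cong (f Fin.zero +_) (∑≡sum (f ∘ Fin.suc))

  ∑-cong : ∀ {n} {f g : Fin n → Carrier} → (∀ i → f i ≈ g i) → ∑ f ≈ ∑ g
  ∑-cong {f = f} {g} f≈g = begin
    ∑ f   ≡⟨ ∑≡sum f ⟩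
    sum f ≈⟨ sum-cong-≋ f≈g ⟩
    sum g ≡⟨ ∑≡sum g ⟨
    ∑ g   ∎

  ∑-zero : ∀ {n} {f : Fin n → Carrier} → (∀ i → f i ≈ 0#) → ∑ f ≈ 0#
  ∑-zero {n} f≈0 = trans (∑-cong f≈0) (trans (reflexive (∑≡sum {n} λ _ → 0#)) (sum-replicate-zero n))

  ∑-+ : ∀ {n} (f g : Fin n → Carrier) → ∑ (λ i → f i + g i) ≈ ∑ f + ∑ g
  ∑-+ f g = begin
    ∑ (λ i → f i + g i)   ≡⟨ ∑≡sum (λ i → f i + g i) ⟩
    sum (λ i → f i + g i) ≈⟨ ∑-distrib-+ f g ⟩
    sum f + sum g         ≡⟨ ≡.cong₂ _+_ (∑≡sum f) (∑≡sum g) ⟨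
    ∑ f + ∑ g             ∎

  ∑-swap : ∀ {m n} (f : Fin m → Fin n → Carrier) →
           ∑ (λ i → ∑ (λ j → f i j)) ≈ ∑ (λ j → ∑ (λ i → f i j))
  ∑-swap {m} {n} f = begin
    ∑ (λ i → ∑ (f i))                   ≡⟨ ≡.trans (∑≡sum {m} _) (sum-cong-≗ λ i → ∑≡sum (f i)) ⟩
    sum (λ i → sum (f i))               ≈⟨ ∑-comm f ⟩
    sum (λ j → sum (λ i → f i j))       ≡⟨ ≡.trans (∑≡sum {n} _) (sum-cong-≗ λ j → ∑≡sum {m} λ i → f i j) ⟨
    ∑ (λ j → ∑ (λ i → f i j))           ∎

  ∑-*ˡ : ∀ {n} x (f : Fin n → Carrier) → x * ∑ f ≈ ∑ (λ i → x * f i)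
  ∑-*ˡ x f = begin
    x * ∑ f              ≡⟨ ≡.cong (x *_) (∑≡sum f) ⟩
    x * sum f            ≈⟨ *-distribˡ-sum x f ⟩
    sum (λ i → x * f i)  ≡⟨ ∑≡sum (λ i → x * f i) ⟨
    ∑ (λ i → x * f i)    ∎

  ∑-*ʳ : ∀ {n} x (f : Fin n → Carrier) → ∑ f * x ≈ ∑ (λ i → f i * x)
  ∑-*ʳ x f = trans (*-comm _ x) (trans (∑-*ˡ x f) (∑-cong λ i → *-comm x (f i)))

  ∑-neg : ∀ {n} (f : Fin n → Carrier) → ∑ (λ i → - f i) ≈ - ∑ f
  ∑-neg f = +-inverseʳ-unique (∑ f) _ (begin
    ∑ f + ∑ (λ i → - f i)  ≈⟨ ∑-+ f _ ⟨
    ∑ (λ i → f i - f i)    ≈⟨ ∑-zero (λ i → -‿inverseʳ (f i)) ⟩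
    0#                     ∎)
    where open RingProperties ring using (+-inverseʳ-unique)

  ∑-split : ∀ m {k} (f : Fin (m ℕ.+ k) → Carrier) →
            ∑ f ≈ ∑ (λ i → f (i ↑ˡ k)) + ∑ (λ i → f (m ↑ʳ i))
  ∑-split zero f = sym (+-identityˡ _)
  ∑-split (suc m) f = trans (+-congˡ (∑-split m (f ∘ Fin.suc))) (sym (+-assoc _ _ _))

  ∑-single : ∀ {n} (f : Fin n → Carrier) (i₀ : Fin n) → (∀ i → i ≢ i₀ → f i ≈ 0#) → ∑ f ≈ f i₀
  ∑-single f Fin.zero f≈0 =
    trans (+-congˡ (∑-zero λ i → f≈0 (Fin.suc i) λ ())) (+-identityʳ _)
  ∑-single f (Fin.suc i₀) f≈0 =
    trans (+-congʳ (f≈0 Fin.zero λ ()))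
      (trans (+-identityˡ _) (∑-single (f ∘ Fin.suc) i₀ λ i i≢i₀ → f≈0 (Fin.suc i) (i≢i₀ ∘ Fin.suc-injective)))

  ΣRange-cong : ∀ a n {f g : ℕ → Carrier} → (∀ i → i < a ℕ.+ n → f i ≈ g i) → ΣRange R a n f ≈ ΣRange R a n g
  ΣRange-cong a zero f≈g = refl
  ΣRange-cong a (suc n) f≈g = +-cong (f≈g a (ℕ.m<m+n a (s≤s z≤n)))
    (ΣRange-cong (suc a) n λ i i< → f≈g i (≡.subst (i <_) (≡.sym (ℕ.+-suc a n)) i<))

  ΣRange-shift : ∀ b a n (f : ℕ → Carrier) → ΣRange R (b ℕ.+ a) n f ≈ ΣRange R b n (λ k → f (k ℕ.+ a))
  ΣRange-shift b a zero f = refl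
  ΣRange-shift b a (suc n) f = +-congˡ (ΣRange-shift (suc b) a n f)

  ΣRange-split : ∀ a p q (f : ℕ → Carrier) → ΣRange R a (p ℕ.+ q) f ≈ ΣRange R a p f + ΣRange R (a ℕ.+ p) q f
  ΣRange-split a zero q f = trans (reflexive (≡.cong (λ b → ΣRange R b q f) (≡.sym (ℕ.+-identityʳ a)))) (sym (+-identityˡ _))
  ΣRange-split a (suc p) q f = trans (+-congˡ (ΣRange-split (suc a) p q f))
    (trans (sym (+-assoc _ _ _)) (+-congˡ (reflexive (≡.cong (λ b → ΣRange R b q f) (≡.sym (ℕ.+-suc a p))))))

  ΣRange-*ˡ : ∀ x a n (f : ℕ → Carrier) → x * ΣRange R a n f ≈ ΣRange R a n (λ i → x * f i)
  ΣRange-*ˡ x a zero f = zeroʳ x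
  ΣRange-*ˡ x a (suc n) f = trans (distribˡ x _ _) (+-congˡ (ΣRange-*ˡ x (suc a) n f))

  ∑≈ΣRange : ∀ n (f : ℕ → Carrier) → ∑ {n} (λ l → f (toℕ l)) ≈ ΣRange R 0 n f
  ∑≈ΣRange n f = trans (∑-cong {n} λ l → reflexive (≡.cong f (≡.sym (ℕ.+-identityʳ (toℕ l))))) (from n 0)
    where
      from : ∀ n a → ∑ {n} (λ l → f (toℕ l ℕ.+ a)) ≈ ΣRange R a n f
      from zero a = refl
      from (suc n) a =
        +-congˡ (trans (∑-cong {n} λ l → reflexive (≡.cong f (≡.sym (ℕ.+-suc (toℕ l) a)))) (from n (suc a)))

module Matrices {c ℓ} (R : CommutativeRing c ℓ) where
  open CommutativeRing R
  open Sums R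
  open RingProperties ring using (-‿distribˡ-*; -‿distribʳ-*)
  open import Algebra.Properties.CommutativeSemigroup *-commutativeSemigroup using (x∙yz≈y∙xz)
  open import Relation.Nullary.Decidable using (dec-true; dec-false)
  open import Algebra.Bundles using (Ring; AbelianGroup)
  import Algebra.Properties.AbelianGroup as AbelianGroupProperties

  δ-refl : ∀ i → δ R i i ≡ 1#
  δ-refl i = ≡.cong (λ b → if b then 1# else 0#) (dec-true (i ℕ.≟ i) ≡.refl)

  δ-≢ : ∀ {i j} → i ≢ j → δ R i j ≡ 0#
  δ-≢ {i} {j} i≢j = ≡.cong (λ b → if b then 1# else 0#) (dec-false (i ℕ.≟ j) i≢j)

  δ-sym : ∀ i j → δ R i j ≡ δ R j i
  δ-sym i j with i ℕ.≟ j
  ... | yes ≡.refl = ≡.refl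
  ... | no i≢j = ≡.trans (δ-≢ i≢j) (≡.sym (δ-≢ (i≢j ∘ ≡.sym)))

  ∑-δˡ : ∀ {n} (f : Fin n → Carrier) (k : Fin n) → ∑ (λ i → δ R (toℕ k) (toℕ i) * f i) ≈ f k
  ∑-δˡ f k = trans (∑-single _ k λ i i≢k → trans (*-congʳ (reflexive (δ-≢ (i≢k ∘ ≡.sym ∘ Fin.toℕ-injective)))) (zeroˡ _))
                   (trans (*-congʳ (reflexive (δ-refl (toℕ k)))) (*-identityˡ (f k)))

  ∑-δʳ : ∀ {n} (f : Fin n → Carrier) (k : Fin n) → ∑ (λ i → f i * δ R (toℕ i) (toℕ k)) ≈ f k
  ∑-δʳ {n} f k = trans (∑-cong {n} λ i → trans (*-comm _ _) (*-congʳ (reflexive (δ-sym (toℕ i) (toℕ k))))) (∑-δˡ f k)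

  infix  4 _≋_
  infixl 7 _∙_
  infixl 6 _⊕_
  infix  8 ⊖_
  infix  9 _ᵗ

  record _≋_ {m n} (A B : Mat R m n) : Set ℓ where
    constructor mk≋
    field entrywise : ∀ i j → A i j ≈ B i j
  open _≋_ public

  ≋-setoid : ℕ → ℕ → Setoid c ℓ
  ≋-setoid m n = record
    { Carrier = Mat R m n
    ; _≈_ = _≋_
    ; isEquivalence = record
      { refl = mk≋ λ i j → refl
      ; sym = λ A≋B → mk≋ λ i j → sym (entrywise A≋B i j)
      ; trans = λ A≋B B≋C → mk≋ λ i j → trans (entrywise A≋B i j) (entrywise B≋C i j)
      }
    }

  module _ {m n : ℕ} where
    open Setoid (≋-setoid m n) public
      using () renaming (refl to ≋-refl; sym to ≋-sym; trans to ≋-trans)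

  module ≋-Reasoning {m n : ℕ} = Relation.Binary.Reasoning.Setoid (≋-setoid m n)

  _∙_ : ∀ {m k n} → Mat R m k → Mat R k n → Mat R m n
  A ∙ B = _·_ R A B

  _⊕_ : ∀ {m n} → Mat R m n → Mat R m n → Mat R m n
  (A ⊕ B) i j = A i j + B i j

  ⊖_ : ∀ {m n} → Mat R m n → Mat R m n
  ⊖_ = negM R

  𝟎 : ∀ {m n} → Mat R m n
  𝟎 i j = 0#

  𝟏 : ∀ n → Mat R n n
  𝟏 = Iₙ R

  _ᵗ : ∀ {m n} → Mat R m n → Mat R n m
  _ᵗ = _ᵀ R

  infixr 7 _•_
  _•_ : ∀ {m n} → Carrier → Mat R m n → Mat R m n
  (x • A) i j = x * A i j

  row : ∀ {m n} → Fin m → Mat R m n → Mat R 1 n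
  row i A _ j = A i j

  row-cong : ∀ {m n} {A B : Mat R m n} i → A ≋ B → row i A ≋ row i B
  row-cong i A≋B = mk≋ λ _ → entrywise A≋B i

  ≋-byRows : ∀ {m n} {A B : Mat R m n} → (∀ i → row i A ≋ row i B) → A ≋ B
  ≋-byRows rows = mk≋ λ i j → entrywise (rows i) Fin.zero j

  ∙-cong : ∀ {m k n} {A A' : Mat R m k} {B B' : Mat R k n} → A ≋ A' → B ≋ B' → A ∙ B ≋ A' ∙ B'
  ∙-cong {k = k} A≋ B≋ = mk≋ λ i j → ∑-cong {k} λ l → *-cong (entrywise A≋ i l) (entrywise B≋ l j)

  ∙-congˡ : ∀ {m k n} {A : Mat R m k} {B B' : Mat R k n} → B ≋ B' → A ∙ B ≋ A ∙ B'
  ∙-congˡ = ∙-cong ≋-refl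

  ∙-congʳ : ∀ {m k n} {A A' : Mat R m k} {B : Mat R k n} → A ≋ A' → A ∙ B ≋ A' ∙ B
  ∙-congʳ A≋ = ∙-cong A≋ ≋-refl

  ⊕-cong : ∀ {m n} {A A' B B' : Mat R m n} → A ≋ A' → B ≋ B' → A ⊕ B ≋ A' ⊕ B'
  ⊕-cong A≋ B≋ = mk≋ λ i j → +-cong (entrywise A≋ i j) (entrywise B≋ i j)

  ⊖-cong : ∀ {m n} {A A' : Mat R m n} → A ≋ A' → ⊖ A ≋ ⊖ A'
  ⊖-cong A≋ = mk≋ λ i j → -‿cong (entrywise A≋ i j)

  ᵗ-cong : ∀ {m n} {A A' : Mat R m n} → A ≋ A' → A ᵗ ≋ A' ᵗ
  ᵗ-cong A≋ = mk≋ λ i j → entrywise A≋ j i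

  ∙-assoc : ∀ {m k l n} (A : Mat R m k) (B : Mat R k l) (C : Mat R l n) → (A ∙ B) ∙ C ≋ A ∙ (B ∙ C)
  ∙-assoc {k = k} {l} A B C = mk≋ λ i j → begin
    ∑ (λ q → ∑ (λ p → A i p * B p q) * C q j)   ≈⟨ ∑-cong {l} (λ q → ∑-*ʳ (C q j) λ p → A i p * B p q) ⟩
    ∑ (λ q → ∑ (λ p → A i p * B p q * C q j))   ≈⟨ ∑-swap (λ q p → A i p * B p q * C q j) ⟩
    ∑ (λ p → ∑ (λ q → A i p * B p q * C q j))   ≈⟨ ∑-cong {k} (λ p → ∑-cong {l} λ q → *-assoc _ _ _) ⟩
    ∑ (λ p → ∑ (λ q → A i p * (B p q * C q j))) ≈⟨ ∑-cong {k} (λ p → ∑-*ˡ (A i p) λ q → B p q * C q j) ⟨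
    ∑ (λ p → A i p * ∑ (λ q → B p q * C q j))   ∎
    where open ≈-Reasoning

  ∙-distribˡ : ∀ {m k n} (A : Mat R m k) (B C : Mat R k n) → A ∙ (B ⊕ C) ≋ A ∙ B ⊕ A ∙ C
  ∙-distribˡ {k = k} A B C = mk≋ λ i j → trans (∑-cong {k} λ l → distribˡ (A i l) _ _) (∑-+ {k} _ _)

  ∙-distribʳ : ∀ {m k n} (A B : Mat R m k) (C : Mat R k n) → (A ⊕ B) ∙ C ≋ A ∙ C ⊕ B ∙ C
  ∙-distribʳ {k = k} A B C = mk≋ λ i j → trans (∑-cong {k} λ l → distribʳ (C l j) _ _) (∑-+ {k} _ _)

  𝟏-∙ : ∀ {m n} (A : Mat R m n) → 𝟏 m ∙ A ≋ A
  𝟏-∙ A = mk≋ λ i j → ∑-δˡ (λ l → A l j) i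

  ∙-𝟏 : ∀ {m n} (A : Mat R m n) → A ∙ 𝟏 n ≋ A
  ∙-𝟏 A = mk≋ λ i j → ∑-δʳ (A i) j

  ⊖-∙ : ∀ {m k n} (A : Mat R m k) (B : Mat R k n) → ⊖ A ∙ B ≋ ⊖ (A ∙ B)
  ⊖-∙ {k = k} A B = mk≋ λ i j → trans (∑-cong {k} λ l → sym (-‿distribˡ-* _ _)) (∑-neg {k} _)

  ∙-⊖ : ∀ {m k n} (A : Mat R m k) (B : Mat R k n) → A ∙ ⊖ B ≋ ⊖ (A ∙ B)
  ∙-⊖ {k = k} A B = mk≋ λ i j → trans (∑-cong {k} λ l → sym (-‿distribʳ-* _ _)) (∑-neg {k} _)

  ᵗ-∙ : ∀ {m k n} (A : Mat R m k) (B : Mat R k n) → (A ∙ B) ᵗ ≋ B ᵗ ∙ A ᵗ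
  ᵗ-∙ {k = k} A B = mk≋ λ i j → ∑-cong {k} λ l → *-comm _ _

  𝟏ᵗ : ∀ n → 𝟏 n ᵗ ≋ 𝟏 n
  𝟏ᵗ n = mk≋ λ i j → reflexive (δ-sym (toℕ j) (toℕ i))

  ᵗ-comm : ∀ {n} {A B : Mat R n n} → A ∙ B ≋ B ∙ A → A ᵗ ∙ B ᵗ ≋ B ᵗ ∙ A ᵗ
  ᵗ-comm {A = A} {B} AB≋BA = ≋-trans (≋-sym (ᵗ-∙ B A)) (≋-trans (ᵗ-cong (≋-sym AB≋BA)) (ᵗ-∙ A B))

  𝟎-∙ : ∀ {m k n} (A : Mat R k n) → 𝟎 {m} ∙ A ≋ 𝟎
  𝟎-∙ {k = k} A = mk≋ λ i j → ∑-zero {k} λ l → zeroˡ _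

  matrixAbelianGroup : ℕ → ℕ → AbelianGroup c ℓ
  matrixAbelianGroup m n = record
    { Carrier = Mat R m n
    ; _≈_ = _≋_
    ; _∙_ = _⊕_
    ; ε = 𝟎
    ; _⁻¹ = ⊖_
    ; isAbelianGroup = record
      { isGroup = record
        { isMonoid = record
          { isSemigroup = record
            { isMagma = record { isEquivalence = Setoid.isEquivalence (≋-setoid m n) ; ∙-cong = ⊕-cong }
            ; assoc = λ A B C → mk≋ λ i j → +-assoc _ _ _
            }
          ; identity = (λ A → mk≋ λ i j → +-identityˡ _) , (λ A → mk≋ λ i j → +-identityʳ _)
          }
        ; inverse = (λ A → mk≋ λ i j → -‿inverseˡ _) , (λ A → mk≋ λ i j → -‿inverseʳ _)
        ; ⁻¹-cong = ⊖-cong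
        }
      ; comm = λ A B → mk≋ λ i j → +-comm _ _
      }
    }

  lincomb : ∀ {k m n} → (Fin k → Carrier) → (Fin k → Mat R m n) → Mat R m n
  lincomb v F r s = ∑ (λ i → v i * F i r s)

  lincomb-cong : ∀ {k m n} (v : Fin k → Carrier) {F F' : Fin k → Mat R m n} →
                 (∀ i → F i ≋ F' i) → lincomb v F ≋ lincomb v F'
  lincomb-cong {k} v F≋ = mk≋ λ r s → ∑-cong {k} λ i → *-congˡ (entrywise (F≋ i) r s)

  lincomb-∙ : ∀ {k l m n} (v : Fin k → Carrier) (F : Fin k → Mat R m l) (M : Mat R l n) →
              lincomb v F ∙ M ≋ lincomb v (λ i → F i ∙ M)
  lincomb-∙ {k} {l} v F M = mk≋ λ r s → begin
    ∑ (λ q → ∑ (λ i → v i * F i r q) * M q s)      ≈⟨ ∑-cong {l} (λ q → ∑-*ʳ (M q s) λ i → v i * F i r q) ⟩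
    ∑ (λ q → ∑ (λ i → v i * F i r q * M q s))      ≈⟨ ∑-swap (λ q i → v i * F i r q * M q s) ⟩
    ∑ (λ i → ∑ (λ q → v i * F i r q * M q s))      ≈⟨ ∑-cong {k} (λ i → ∑-cong {l} λ q → *-assoc _ _ _) ⟩
    ∑ (λ i → ∑ (λ q → v i * (F i r q * M q s)))    ≈⟨ ∑-cong {k} (λ i → ∑-*ˡ (v i) λ q → F i r q * M q s) ⟨
    ∑ (λ i → v i * ∑ (λ q → F i r q * M q s))      ∎
    where open ≈-Reasoning

  ∙-lincomb : ∀ {k l m n} (v : Fin k → Carrier) (M : Mat R m l) (F : Fin k → Mat R l n) →
              M ∙ lincomb v F ≋ lincomb v (λ i → M ∙ F i)
  ∙-lincomb {k} {l} v M F = mk≋ λ r s → begin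
    ∑ (λ q → M r q * ∑ (λ i → v i * F i q s))      ≈⟨ ∑-cong {l} (λ q → ∑-*ˡ (M r q) λ i → v i * F i q s) ⟩
    ∑ (λ q → ∑ (λ i → M r q * (v i * F i q s)))    ≈⟨ ∑-swap (λ q i → M r q * (v i * F i q s)) ⟩
    ∑ (λ i → ∑ (λ q → M r q * (v i * F i q s)))    ≈⟨ ∑-cong {k} (λ i → ∑-cong {l} λ q → x∙yz≈y∙xz _ _ _) ⟩
    ∑ (λ i → ∑ (λ q → v i * (M r q * F i q s)))    ≈⟨ ∑-cong {k} (λ i → ∑-*ˡ (v i) λ q → M r q * F i q s) ⟨
    ∑ (λ i → v i * ∑ (λ q → M r q * F i q s))      ∎
    where open ≈-Reasoning

  module _ {m n : ℕ} where
    open AbelianGroup (matrixAbelianGroup m n) public using ()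
      renaming (∙-congˡ to ⊕-congˡ; ∙-congʳ to ⊕-congʳ; comm to ⊕-comm;
                inverseˡ to ⊖-inverseˡ; inverseʳ to ⊖-inverseʳ)
    open AbelianGroupProperties (matrixAbelianGroup m n) public using ()
      renaming (⁻¹-involutive to ⊖-involutive; inverseˡ-unique to ⊕-inverseˡ-unique;
                inverseʳ-unique to ⊕-inverseʳ-unique; ε⁻¹≈ε to ⊖𝟎; ⁻¹-injective to ⊖-injective)

  ∙-⊖𝟏 : ∀ {m n} (A : Mat R m n) → A ∙ ⊖ 𝟏 n ≋ ⊖ A
  ∙-⊖𝟏 A = ≋-trans (∙-⊖ A (𝟏 _)) (⊖-cong (∙-𝟏 A))

  ⊖-∙-⊖ : ∀ {m k n} (A : Mat R m k) (B : Mat R k n) → ⊖ A ∙ ⊖ B ≋ A ∙ B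
  ⊖-∙-⊖ A B = ≋-trans (⊖-∙ A (⊖ B)) (≋-trans (⊖-cong (∙-⊖ A B)) (⊖-involutive (A ∙ B)))

  matrixRing : ℕ → Ring c ℓ
  matrixRing n = record
    { Carrier = Mat R n n
    ; _≈_ = _≋_
    ; _+_ = _⊕_
    ; _*_ = _∙_
    ; -_ = ⊖_
    ; 0# = 𝟎
    ; 1# = 𝟏 n
    ; isRing = record
      { +-isAbelianGroup = AbelianGroup.isAbelianGroup (matrixAbelianGroup n n)
      ; *-cong = ∙-cong
      ; *-assoc = ∙-assoc
      ; *-identity = 𝟏-∙ , ∙-𝟏
      ; distrib = ∙-distribˡ , λ C A B → ∙-distribʳ A B C
      }
    }

  module MonoidSolver (n : ℕ) where
    open import Algebra.Solver.Monoid (Ring.*-monoid (matrixRing n)) public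
      using (solve; _⊜_) renaming (_⊕_ to _⊙_)

  splitAt-elim : ∀ m {n p} (P : Fin (m ℕ.+ n) → Set p) →
                 (∀ i → P (i ↑ˡ n)) → (∀ i → P (m ↑ʳ i)) → ∀ i → P i
  splitAt-elim m {n} P left right i with splitAt m i in eq
  ... | inj₁ i' = ≡.subst P (Fin.splitAt⁻¹-↑ˡ eq) (left i')
  ... | inj₂ i' = ≡.subst P (Fin.splitAt⁻¹-↑ʳ eq) (right i')

  module _ {m n₁ n₂ : ℕ} (A : Mat R m n₁) (B : Mat R m n₂) where
    hcat-↑ˡ : ∀ i j → hcat R A B i (j ↑ˡ n₂) ≡ A i j
    hcat-↑ˡ i j rewrite Fin.splitAt-↑ˡ n₁ j n₂ = ≡.refl

    hcat-↑ʳ : ∀ i j → hcat R A B i (n₁ ↑ʳ j) ≡ B i j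
    hcat-↑ʳ i j rewrite Fin.splitAt-↑ʳ n₁ n₂ j = ≡.refl

  ≋-columnSplit : ∀ {m n₁ n₂} {M M' : Mat R m (n₁ ℕ.+ n₂)} →
    (∀ i j → M i (j ↑ˡ n₂) ≈ M' i (j ↑ˡ n₂)) → (∀ i j → M i (n₁ ↑ʳ j) ≈ M' i (n₁ ↑ʳ j)) → M ≋ M'
  ≋-columnSplit {n₁ = n₁} {M = M} {M'} left right =
    mk≋ λ i → splitAt-elim n₁ (λ j → M i j ≈ M' i j) (left i) (right i)

  module _ {m n₁ n₂ : ℕ} where
    leftCols : Mat R m (n₁ ℕ.+ n₂) → Mat R m n₁
    leftCols M i j = M i (j ↑ˡ n₂)

    rightCols : Mat R m (n₁ ℕ.+ n₂) → Mat R m n₂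
    rightCols M i j = M i (n₁ ↑ʳ j)

    hcat-η : (M : Mat R m (n₁ ℕ.+ n₂)) → M ≋ hcat R (leftCols M) (rightCols M)
    hcat-η M = ≋-columnSplit (λ i j → reflexive (≡.sym (hcat-↑ˡ (leftCols M) (rightCols M) i j)))
                             (λ i j → reflexive (≡.sym (hcat-↑ʳ (leftCols M) (rightCols M) i j)))

  hcat-injective : ∀ {m n₁ n₂} {A A' : Mat R m n₁} {B B' : Mat R m n₂} →
                   hcat R A B ≋ hcat R A' B' → A ≋ A' × B ≋ B'
  hcat-injective {A = A} {A'} {B} {B'} eq =
    mk≋ (λ i j → trans (reflexive (≡.sym (hcat-↑ˡ A B i j))) (trans (entrywise eq i _) (reflexive (hcat-↑ˡ A' B' i j)))) ,
    mk≋ (λ i j → trans (reflexive (≡.sym (hcat-↑ʳ A B i j))) (trans (entrywise eq i _) (reflexive (hcat-↑ʳ A' B' i j))))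

  hcat-cong : ∀ {m n₁ n₂} {A A' : Mat R m n₁} {B B' : Mat R m n₂} →
              A ≋ A' → B ≋ B' → hcat R A B ≋ hcat R A' B'
  hcat-cong {A = A} {A'} {B} {B'} A≋ B≋ = ≋-columnSplit
    (λ i j → trans (reflexive (hcat-↑ˡ A B i j)) (trans (entrywise A≋ i j) (reflexive (≡.sym (hcat-↑ˡ A' B' i j)))))
    (λ i j → trans (reflexive (hcat-↑ʳ A B i j)) (trans (entrywise B≋ i j) (reflexive (≡.sym (hcat-↑ʳ A' B' i j)))))

  ∙-hcat : ∀ {l m n₁ n₂} (M : Mat R l m) (A : Mat R m n₁) (B : Mat R m n₂) →
           M ∙ hcat R A B ≋ hcat R (M ∙ A) (M ∙ B)
  ∙-hcat {m = m} M A B = ≋-columnSplit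
    (λ i j → trans (∑-cong {m} λ l → *-congˡ (reflexive (hcat-↑ˡ A B l j))) (reflexive (≡.sym (hcat-↑ˡ (M ∙ A) (M ∙ B) i j))))
    (λ i j → trans (∑-cong {m} λ l → *-congˡ (reflexive (hcat-↑ʳ A B l j))) (reflexive (≡.sym (hcat-↑ʳ (M ∙ A) (M ∙ B) i j))))

  module _ {m₁ m₂ n₁ n₂ : ℕ} (A : Mat R m₁ n₁) (B : Mat R m₁ n₂) (C : Mat R m₂ n₁) (D : Mat R m₂ n₂) where
    block-↑ˡ↑ˡ : ∀ i j → block R A B C D (i ↑ˡ m₂) (j ↑ˡ n₂) ≡ A i j
    block-↑ˡ↑ˡ i j rewrite Fin.splitAt-↑ˡ m₁ i m₂ | Fin.splitAt-↑ˡ n₁ j n₂ = ≡.refl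

    block-↑ˡ↑ʳ : ∀ i j → block R A B C D (i ↑ˡ m₂) (n₁ ↑ʳ j) ≡ B i j
    block-↑ˡ↑ʳ i j rewrite Fin.splitAt-↑ˡ m₁ i m₂ | Fin.splitAt-↑ʳ n₁ n₂ j = ≡.refl

    block-↑ʳ↑ˡ : ∀ i j → block R A B C D (m₁ ↑ʳ i) (j ↑ˡ n₂) ≡ C i j
    block-↑ʳ↑ˡ i j rewrite Fin.splitAt-↑ʳ m₁ m₂ i | Fin.splitAt-↑ˡ n₁ j n₂ = ≡.refl

    block-↑ʳ↑ʳ : ∀ i j → block R A B C D (m₁ ↑ʳ i) (n₁ ↑ʳ j) ≡ D i j
    block-↑ʳ↑ʳ i j rewrite Fin.splitAt-↑ʳ m₁ m₂ i | Fin.splitAt-↑ʳ n₁ n₂ j = ≡.refl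

  ≋-blockSplit : ∀ {m₁ m₂ n₁ n₂} {M M' : Mat R (m₁ ℕ.+ m₂) (n₁ ℕ.+ n₂)} →
    (∀ i j → M (i ↑ˡ m₂) (j ↑ˡ n₂) ≈ M' (i ↑ˡ m₂) (j ↑ˡ n₂)) →
    (∀ i j → M (i ↑ˡ m₂) (n₁ ↑ʳ j) ≈ M' (i ↑ˡ m₂) (n₁ ↑ʳ j)) →
    (∀ i j → M (m₁ ↑ʳ i) (j ↑ˡ n₂) ≈ M' (m₁ ↑ʳ i) (j ↑ˡ n₂)) →
    (∀ i j → M (m₁ ↑ʳ i) (n₁ ↑ʳ j) ≈ M' (m₁ ↑ʳ i) (n₁ ↑ʳ j)) → M ≋ M'
  ≋-blockSplit {m₁} {n₁ = n₁} {M = M} {M'} ≈₁₁ ≈₁₂ ≈₂₁ ≈₂₂ = mk≋ λ i j →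
    splitAt-elim m₁ (λ i → M i j ≈ M' i j)
      (λ i → splitAt-elim n₁ (λ j → M (i ↑ˡ _) j ≈ M' (i ↑ˡ _) j) (≈₁₁ i) (≈₁₂ i) j)
      (λ i → splitAt-elim n₁ (λ j → M (m₁ ↑ʳ i) j ≈ M' (m₁ ↑ʳ i) j) (≈₂₁ i) (≈₂₂ i) j) i

  block-cong : ∀ {m₁ m₂ n₁ n₂} {A A' : Mat R m₁ n₁} {B B' : Mat R m₁ n₂} {C C' : Mat R m₂ n₁} {D D' : Mat R m₂ n₂} →
               A ≋ A' → B ≋ B' → C ≋ C' → D ≋ D' → block R A B C D ≋ block R A' B' C' D'
  block-cong {A = A} {A'} {B} {B'} {C} {C'} {D} {D'} A≋ B≋ C≋ D≋ = ≋-blockSplit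
    (λ i j → trans (reflexive (block-↑ˡ↑ˡ A B C D i j)) (trans (entrywise A≋ i j) (reflexive (≡.sym (block-↑ˡ↑ˡ A' B' C' D' i j)))))
    (λ i j → trans (reflexive (block-↑ˡ↑ʳ A B C D i j)) (trans (entrywise B≋ i j) (reflexive (≡.sym (block-↑ˡ↑ʳ A' B' C' D' i j)))))
    (λ i j → trans (reflexive (block-↑ʳ↑ˡ A B C D i j)) (trans (entrywise C≋ i j) (reflexive (≡.sym (block-↑ʳ↑ˡ A' B' C' D' i j)))))
    (λ i j → trans (reflexive (block-↑ʳ↑ʳ A B C D i j)) (trans (entrywise D≋ i j) (reflexive (≡.sym (block-↑ʳ↑ʳ A' B' C' D' i j)))))

  block-injective : ∀ {m₁ m₂ n₁ n₂} {A A' : Mat R m₁ n₁} {B B' : Mat R m₁ n₂} {C C' : Mat R m₂ n₁} {D D' : Mat R m₂ n₂} →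
                    block R A B C D ≋ block R A' B' C' D' → A ≋ A' × B ≋ B' × C ≋ C' × D ≋ D'
  block-injective {A = A} {A'} {B} {B'} {C} {C'} {D} {D'} eq =
    mk≋ (λ i j → trans (reflexive (≡.sym (block-↑ˡ↑ˡ A B C D i j))) (trans (entrywise eq _ _) (reflexive (block-↑ˡ↑ˡ A' B' C' D' i j)))) ,
    mk≋ (λ i j → trans (reflexive (≡.sym (block-↑ˡ↑ʳ A B C D i j))) (trans (entrywise eq _ _) (reflexive (block-↑ˡ↑ʳ A' B' C' D' i j)))) ,
    mk≋ (λ i j → trans (reflexive (≡.sym (block-↑ʳ↑ˡ A B C D i j))) (trans (entrywise eq _ _) (reflexive (block-↑ʳ↑ˡ A' B' C' D' i j)))) ,
    mk≋ (λ i j → trans (reflexive (≡.sym (block-↑ʳ↑ʳ A B C D i j))) (trans (entrywise eq _ _) (reflexive (block-↑ʳ↑ʳ A' B' C' D' i j))))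

  block-∙ : ∀ {m₁ m₂ k₁ k₂ n₁ n₂}
    (A : Mat R m₁ k₁) (B : Mat R m₁ k₂) (C : Mat R m₂ k₁) (D : Mat R m₂ k₂)
    (E : Mat R k₁ n₁) (F : Mat R k₁ n₂) (G : Mat R k₂ n₁) (H : Mat R k₂ n₂) →
    block R A B C D ∙ block R E F G H ≋
    block R (A ∙ E ⊕ B ∙ G) (A ∙ F ⊕ B ∙ H) (C ∙ E ⊕ D ∙ G) (C ∙ F ⊕ D ∙ H)
  block-∙ {m₁} {m₂} {k₁} {k₂} {n₁} {n₂} A B C D E F G H = ≋-blockSplit
    (λ i j → corner (i ↑ˡ m₂) (j ↑ˡ n₂) (block-↑ˡ↑ˡ A B C D i) (block-↑ˡ↑ʳ A B C D i)
                    (λ l → block-↑ˡ↑ˡ E F G H l j) (λ l → block-↑ʳ↑ˡ E F G H l j) (block-↑ˡ↑ˡ P₁₁ P₁₂ P₂₁ P₂₂ i j))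
    (λ i j → corner (i ↑ˡ m₂) (n₁ ↑ʳ j) (block-↑ˡ↑ˡ A B C D i) (block-↑ˡ↑ʳ A B C D i)
                    (λ l → block-↑ˡ↑ʳ E F G H l j) (λ l → block-↑ʳ↑ʳ E F G H l j) (block-↑ˡ↑ʳ P₁₁ P₁₂ P₂₁ P₂₂ i j))
    (λ i j → corner (m₁ ↑ʳ i) (j ↑ˡ n₂) (block-↑ʳ↑ˡ A B C D i) (block-↑ʳ↑ʳ A B C D i)
                    (λ l → block-↑ˡ↑ˡ E F G H l j) (λ l → block-↑ʳ↑ˡ E F G H l j) (block-↑ʳ↑ˡ P₁₁ P₁₂ P₂₁ P₂₂ i j))
    (λ i j → corner (m₁ ↑ʳ i) (n₁ ↑ʳ j) (block-↑ʳ↑ˡ A B C D i) (block-↑ʳ↑ʳ A B C D i)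
                    (λ l → block-↑ˡ↑ʳ E F G H l j) (λ l → block-↑ʳ↑ʳ E F G H l j) (block-↑ʳ↑ʳ P₁₁ P₁₂ P₂₁ P₂₂ i j))
    where
      P₁₁ = A ∙ E ⊕ B ∙ G
      P₁₂ = A ∙ F ⊕ B ∙ H
      P₂₁ = C ∙ E ⊕ D ∙ G
      P₂₂ = C ∙ F ⊕ D ∙ H
      M = block R A B C D
      N = block R E F G H
      corner : ∀ r s {x : Carrier} {p : Fin k₁ → Carrier} {q : Fin k₂ → Carrier} {p' : Fin k₁ → Carrier} {q' : Fin k₂ → Carrier} →
               (∀ l → M r (l ↑ˡ k₂) ≡ p l) → (∀ l → M r (k₁ ↑ʳ l) ≡ q l) →
               (∀ l → N (l ↑ˡ k₂) s ≡ p' l) → (∀ l → N (k₁ ↑ʳ l) s ≡ q' l) →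
               x ≡ ∑ (λ l → p l * p' l) + ∑ (λ l → q l * q' l) → (M ∙ N) r s ≈ x
      corner r s Mp Mq Np Nq x≡ = trans (∑-split k₁ λ l → M r l * N l s)
        (trans (+-cong (∑-cong {k₁} λ l → reflexive (≡.cong₂ _*_ (Mp l) (Np l)))
                       (∑-cong {k₂} λ l → reflexive (≡.cong₂ _*_ (Mq l) (Nq l))))
               (reflexive (≡.sym x≡)))

  ↑ˡ≢↑ʳ : ∀ {m n} (i : Fin m) (j : Fin n) → i ↑ˡ n ≢ m ↑ʳ j
  ↑ˡ≢↑ʳ {m} {n} i j eq with () ← ≡.trans (≡.sym (Fin.splitAt-↑ˡ m i n)) (≡.trans (≡.cong (splitAt m) eq) (Fin.splitAt-↑ʳ m n j))

  𝟏-block : ∀ m n → 𝟏 (m ℕ.+ n) ≋ block R (𝟏 m) 𝟎 𝟎 (𝟏 n)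
  𝟏-block m n = ≋-blockSplit
    (λ i j → reflexive (≡.trans (≡.cong₂ (δ R) (Fin.toℕ-↑ˡ i n) (Fin.toℕ-↑ˡ j n)) (≡.sym (block-↑ˡ↑ˡ (𝟏 m) 𝟎 𝟎 (𝟏 n) i j))))
    (λ i j → reflexive (≡.trans (δ-≢ (↑ˡ≢↑ʳ i j ∘ Fin.toℕ-injective)) (≡.sym (block-↑ˡ↑ʳ (𝟏 m) 𝟎 𝟎 (𝟏 n) i j))))
    (λ i j → reflexive (≡.trans (δ-≢ (↑ˡ≢↑ʳ j i ∘ ≡.sym ∘ Fin.toℕ-injective)) (≡.sym (block-↑ʳ↑ˡ (𝟏 m) 𝟎 𝟎 (𝟏 n) i j))))
    (λ i j → reflexive (≡.trans (≡.cong₂ (δ R) (Fin.toℕ-↑ʳ m i) (Fin.toℕ-↑ʳ m j))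
                                (≡.trans (δ-+ m) (≡.sym (block-↑ʳ↑ʳ (𝟏 m) 𝟎 𝟎 (𝟏 n) i j)))))
    where
      δ-+ : ∀ k {a b} → δ R (k ℕ.+ a) (k ℕ.+ b) ≡ δ R a b
      δ-+ zero = ≡.refl
      δ-+ (suc k) = δ-+ k

  ⊖-block : ∀ {m₁ m₂ n₁ n₂} (A : Mat R m₁ n₁) (B : Mat R m₁ n₂) (C : Mat R m₂ n₁) (D : Mat R m₂ n₂) →
            ⊖ block R A B C D ≋ block R (⊖ A) (⊖ B) (⊖ C) (⊖ D)
  ⊖-block A B C D = ≋-blockSplit
    (λ i j → reflexive (≡.trans (≡.cong -_ (block-↑ˡ↑ˡ A B C D i j)) (≡.sym (block-↑ˡ↑ˡ (⊖ A) (⊖ B) (⊖ C) (⊖ D) i j))))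
    (λ i j → reflexive (≡.trans (≡.cong -_ (block-↑ˡ↑ʳ A B C D i j)) (≡.sym (block-↑ˡ↑ʳ (⊖ A) (⊖ B) (⊖ C) (⊖ D) i j))))
    (λ i j → reflexive (≡.trans (≡.cong -_ (block-↑ʳ↑ˡ A B C D i j)) (≡.sym (block-↑ʳ↑ˡ (⊖ A) (⊖ B) (⊖ C) (⊖ D) i j))))
    (λ i j → reflexive (≡.trans (≡.cong -_ (block-↑ʳ↑ʳ A B C D i j)) (≡.sym (block-↑ʳ↑ʳ (⊖ A) (⊖ B) (⊖ C) (⊖ D) i j))))

  ⊖𝟏-block : ∀ m n → ⊖ 𝟏 (m ℕ.+ n) ≋ block R (⊖ 𝟏 m) 𝟎 𝟎 (⊖ 𝟏 n)
  ⊖𝟏-block m n = ≋-trans (⊖-cong (𝟏-block m n))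
    (≋-trans (⊖-block (𝟏 m) 𝟎 𝟎 (𝟏 n)) (block-cong {A = ⊖ 𝟏 m} {D = ⊖ 𝟏 n} ≋-refl ⊖𝟎 ⊖𝟎 ≋-refl))

module Adjoint {c ℓ} (R : CommutativeRing c ℓ) (ι : Involution R) where
  open CommutativeRing R
  open Involution ι public
  open Sums R
  open Matrices R
  open RingProperties ring using (x+x≈x⇒x≈0; +-inverseʳ-unique)

  bar-0 : bar 0# ≈ 0#
  bar-0 = x+x≈x⇒x≈0 (bar 0#) (trans (sym (bar-+ 0# 0#)) (bar-cong (+-identityʳ 0#)))

  bar-neg : ∀ x → bar (- x) ≈ - bar x
  bar-neg x = +-inverseʳ-unique (bar x) (bar (- x))
    (trans (sym (bar-+ x (- x))) (trans (bar-cong (-‿inverseʳ x)) bar-0))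

  bar-δ : ∀ i j → bar (δ R i j) ≈ δ R i j
  bar-δ i j with does (i ℕ.≟ j)
  ... | true = bar-1
  ... | false = bar-0

  ∑-bar : ∀ {n} (f : Fin n → Carrier) → bar (∑ f) ≈ ∑ (λ i → bar (f i))
  ∑-bar {zero} f = bar-0
  ∑-bar {suc n} f = trans (bar-+ _ _) (+-congˡ (∑-bar (f ∘ Fin.suc)))

  infix 9 _ᴴ

  _ᴴ : ∀ {m n} → Mat R m n → Mat R n m
  (A ᴴ) i j = bar (A j i)

  ᴴ-cong : ∀ {m n} {A A' : Mat R m n} → A ≋ A' → A ᴴ ≋ A' ᴴ
  ᴴ-cong A≋ = mk≋ λ i j → bar-cong (entrywise A≋ j i)

  ᴴ-involutive : ∀ {m n} (A : Mat R m n) → A ᴴ ᴴ ≋ A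
  ᴴ-involutive A = mk≋ λ i j → bar-invol (A i j)

  ᴴ-∙ : ∀ {m k n} (A : Mat R m k) (B : Mat R k n) → (A ∙ B) ᴴ ≋ B ᴴ ∙ A ᴴ
  ᴴ-∙ {k = k} A B = mk≋ λ i j → trans (∑-bar {k} _) (∑-cong {k} λ l → trans (bar-* _ _) (*-comm _ _))

  ⊖ᴴ : ∀ {m n} (A : Mat R m n) → (⊖ A) ᴴ ≋ ⊖ (A ᴴ)
  ⊖ᴴ A = mk≋ λ i j → bar-neg (A j i)

  ⊕ᴴ : ∀ {m n} (A B : Mat R m n) → (A ⊕ B) ᴴ ≋ A ᴴ ⊕ B ᴴ
  ⊕ᴴ A B = mk≋ λ i j → bar-+ _ _

  𝟏ᴴ : ∀ n → 𝟏 n ᴴ ≋ 𝟏 n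
  𝟏ᴴ n = mk≋ λ i j → trans (bar-δ (toℕ j) (toℕ i)) (reflexive (δ-sym (toℕ j) (toℕ i)))

  IsNegatedUnitary : ∀ {n} → Mat R n n → Set ℓ
  IsNegatedUnitary {n} X = X ∙ X ᴴ ≋ ⊖ 𝟏 n × X ᴴ ∙ X ≋ ⊖ 𝟏 n

  IsNegatedUnitary-resp : ∀ {n} {X Y : Mat R n n} → X ≋ Y → IsNegatedUnitary X → IsNegatedUnitary Y
  IsNegatedUnitary-resp X≋Y (XXᴴ≋ , XᴴX≋) =
    ≋-trans (∙-cong (≋-sym X≋Y) (ᴴ-cong (≋-sym X≋Y))) XXᴴ≋ , ≋-trans (∙-cong (ᴴ-cong (≋-sym X≋Y)) (≋-sym X≋Y)) XᴴX≋

  ∙ᴴ-hermitian : ∀ {m n} (A : Mat R m n) → (A ∙ A ᴴ) ᴴ ≋ A ∙ A ᴴ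
  ∙ᴴ-hermitian A = ≋-trans (ᴴ-∙ A (A ᴴ)) (∙-congʳ {B = A ᴴ} (ᴴ-involutive A))

  block-ᴴ : ∀ {m₁ m₂ n₁ n₂} (A : Mat R m₁ n₁) (B : Mat R m₁ n₂) (C : Mat R m₂ n₁) (D : Mat R m₂ n₂) →
            block R A B C D ᴴ ≋ block R (A ᴴ) (C ᴴ) (B ᴴ) (D ᴴ)
  block-ᴴ A B C D = ≋-blockSplit
    (λ i j → reflexive (≡.trans (≡.cong bar (block-↑ˡ↑ˡ A B C D j i)) (≡.sym (block-↑ˡ↑ˡ (A ᴴ) (C ᴴ) (B ᴴ) (D ᴴ) i j))))
    (λ i j → reflexive (≡.trans (≡.cong bar (block-↑ʳ↑ˡ A B C D j i)) (≡.sym (block-↑ˡ↑ʳ (A ᴴ) (C ᴴ) (B ᴴ) (D ᴴ) i j))))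
    (λ i j → reflexive (≡.trans (≡.cong bar (block-↑ˡ↑ʳ A B C D j i)) (≡.sym (block-↑ʳ↑ˡ (A ᴴ) (C ᴴ) (B ᴴ) (D ᴴ) i j))))
    (λ i j → reflexive (≡.trans (≡.cong bar (block-↑ʳ↑ʳ A B C D j i)) (≡.sym (block-↑ʳ↑ʳ (A ᴴ) (C ᴴ) (B ᴴ) (D ᴴ) i j))))

  hcat-∙-hcatᴴ : ∀ {m n k₁ k₂} (A : Mat R m k₁) (B : Mat R m k₂) (C : Mat R n k₁) (D : Mat R n k₂) →
                 hcat R A B ∙ hcat R C D ᴴ ≋ A ∙ C ᴴ ⊕ B ∙ D ᴴ
  hcat-∙-hcatᴴ {k₁ = k₁} {k₂} A B C D = mk≋ λ i j → trans (∑-split k₁ _)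
    (+-cong (∑-cong {k₁} λ l → reflexive (≡.cong₂ (λ x y → x * bar y) (hcat-↑ˡ A B i l) (hcat-↑ˡ C D j l)))
            (∑-cong {k₂} λ l → reflexive (≡.cong₂ (λ x y → x * bar y) (hcat-↑ʳ A B i l) (hcat-↑ʳ C D j l))))

module SelfDualityCriterion {c ℓ} (R : CommutativeRing c ℓ) (ι : Involution R) {k : ℕ} (X : Mat R k k) where
  open CommutativeRing R
  open Sums R
  open Matrices R
  open Adjoint R ι

  G : Mat R k (k ℕ.+ k)
  G = hcat R (𝟏 k) X

  Code : Vect R (k ℕ.+ k) → Set (c ⊔ ℓ)
  Code = RowSpace R G

  ⌊_⌋ : ∀ {n} → Vect R n → Mat R 1 n
  ⌊ x ⌋ _ = x

  row∈Code : ∀ i → Code (λ j → G i j)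
  row∈Code i = (λ l → 𝟏 k i l) , λ j → sym (∑-δˡ (λ l → G l j) i)

  module _ (x : Vect R (k ℕ.+ k)) where
    x₁ x₂ : Mat R 1 k
    x₁ = leftCols ⌊ x ⌋
    x₂ = rightCols ⌊ x ⌋

    x≋halves : ⌊ x ⌋ ≋ hcat R x₁ x₂
    x≋halves = hcat-η {n₁ = k} {n₂ = k} ⌊ x ⌋

    code⇔ : Code x ⇔ x₂ ≋ x₁ ∙ X
    code⇔ = mk⇔ to from
      where
        to : Code x → x₂ ≋ x₁ ∙ X
        to (u , x≈uG) = ≋-trans (proj₂ halves) (∙-congʳ (≋-sym (≋-trans (proj₁ halves) (∙-𝟏 ⌊ u ⌋))))
          where
            halves : x₁ ≋ ⌊ u ⌋ ∙ 𝟏 k × x₂ ≋ ⌊ u ⌋ ∙ X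
            halves = hcat-injective (≋-trans (≋-sym x≋halves) (≋-trans (mk≋ λ _ → x≈uG) (∙-hcat ⌊ u ⌋ (𝟏 k) X)))
        from : x₂ ≋ x₁ ∙ X → Code x
        from x₂≋ = (λ j → x (j ↑ˡ k)) , entrywise x≋ Fin.zero
          where
            x≋ : ⌊ x ⌋ ≋ x₁ ∙ G
            x≋ = ≋-trans x≋halves (≋-trans (hcat-cong (≋-sym (∙-𝟏 x₁)) x₂≋) (≋-sym (∙-hcat x₁ (𝟏 k) X)))

    ∙Gᴴ : ⌊ x ⌋ ∙ G ᴴ ≋ x₁ ⊕ x₂ ∙ X ᴴ
    ∙Gᴴ = ≋-trans (∙-congʳ x≋halves) (≋-trans (hcat-∙-hcatᴴ x₁ x₂ (𝟏 k) X)
                   (⊕-cong (≋-trans (∙-congˡ (𝟏ᴴ k)) (∙-𝟏 x₁)) ≋-refl))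

    dual⇔ : HermDual R ι Code x ⇔ x₁ ⊕ x₂ ∙ X ᴴ ≋ 𝟎
    dual⇔ = mk⇔ (λ dual → ≋-trans (≋-sym ∙Gᴴ) (mk≋ λ _ i → dual _ (row∈Code i)))
                (λ orth y (v , y≈vG) → entrywise (x⊥y orth v (mk≋ λ _ → y≈vG)) Fin.zero Fin.zero)
      where
        x⊥y : x₁ ⊕ x₂ ∙ X ᴴ ≋ 𝟎 → ∀ v {y} → ⌊ y ⌋ ≋ ⌊ v ⌋ ∙ G → ⌊ x ⌋ ∙ ⌊ y ⌋ ᴴ ≋ 𝟎
        x⊥y orth v {y} y≋ = begin
          ⌊ x ⌋ ∙ ⌊ y ⌋ ᴴ            ≈⟨ ∙-congˡ (≋-trans (ᴴ-cong y≋) (ᴴ-∙ ⌊ v ⌋ G)) ⟩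
          ⌊ x ⌋ ∙ (G ᴴ ∙ ⌊ v ⌋ ᴴ)    ≈⟨ ∙-assoc ⌊ x ⌋ (G ᴴ) (⌊ v ⌋ ᴴ) ⟨
          (⌊ x ⌋ ∙ G ᴴ) ∙ ⌊ v ⌋ ᴴ    ≈⟨ ∙-congʳ (≋-trans ∙Gᴴ orth) ⟩
          𝟎 ∙ ⌊ v ⌋ ᴴ                ≈⟨ 𝟎-∙ (⌊ v ⌋ ᴴ) ⟩
          𝟎                          ∎
          where open ≋-Reasoning

  selfDual⇔ : IsHermitianSelfDual R ι Code ⇔ IsNegatedUnitary X
  selfDual⇔ = mk⇔ (λ (closed , complete) → ≋-byRows (XXᴴ-row closed) , ≋-byRows (XᴴX-row complete))
                  (λ (XXᴴ≋ , XᴴX≋) → closed XXᴴ≋ , complete XᴴX≋)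
    where
      open ≋-Reasoning

      XXᴴ-row : (∀ x → Code x → HermDual R ι Code x) → ∀ i → row i (X ∙ X ᴴ) ≋ row i (⊖ 𝟏 k)
      XXᴴ-row closed i = ⊕-inverseʳ-unique (row i (𝟏 k)) (row i (X ∙ X ᴴ)) (begin
        row i (𝟏 k) ⊕ row i X ∙ X ᴴ    ≈⟨ ⊕-cong (mk≋ λ _ j → reflexive (≡.sym (hcat-↑ˡ (𝟏 k) X i j)))
                                                   (∙-congʳ (mk≋ λ _ j → reflexive (≡.sym (hcat-↑ʳ (𝟏 k) X i j)))) ⟩
        x₁ Gᵢ ⊕ x₂ Gᵢ ∙ X ᴴ            ≈⟨ Equivalence.to (dual⇔ Gᵢ) (closed Gᵢ (row∈Code i)) ⟩
        𝟎                              ∎)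
        where Gᵢ = λ j → G i j

      -- v = (−eₗ Xᴴ , eₗ) is orthogonal to every row of G; being in the code forces eₗ = −eₗ Xᴴ X.
      XᴴX-row : (∀ x → HermDual R ι Code x → Code x) → ∀ l → row l (X ᴴ ∙ X) ≋ row l (⊖ 𝟏 k)
      XᴴX-row complete l = begin
        row l (X ᴴ ∙ X)               ≈⟨ row-cong l (𝟏-∙ (X ᴴ ∙ X)) ⟨
        row l (𝟏 k) ∙ (X ᴴ ∙ X)       ≈⟨ ∙-assoc (row l (𝟏 k)) (X ᴴ) X ⟨
        (row l (𝟏 k) ∙ X ᴴ) ∙ X       ≈⟨ ⊖-involutive _ ⟨
        ⊖ ⊖ ((row l (𝟏 k) ∙ X ᴴ) ∙ X) ≈⟨ ⊖-cong (⊖-∙ (row l (𝟏 k) ∙ X ᴴ) X) ⟨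
        ⊖ (y ∙ X)                     ≈⟨ ⊖-cong (∙-congʳ y≋) ⟨
        ⊖ (x₁ v ∙ X)                  ≈⟨ ⊖-cong (Equivalence.to (code⇔ v) (complete v v⊥)) ⟨
        ⊖ x₂ v                        ≈⟨ ⊖-cong z≋ ⟩
        ⊖ row l (𝟏 k)                 ∎
        where
          y z : Mat R 1 k
          y = ⊖ (row l (𝟏 k) ∙ X ᴴ)
          z = row l (𝟏 k)
          v : Vect R (k ℕ.+ k)
          v = hcat R y z Fin.zero
          y≋ : x₁ v ≋ y
          y≋ = mk≋ λ _ j → reflexive (hcat-↑ˡ y z Fin.zero j)
          z≋ : x₂ v ≋ z
          z≋ = mk≋ λ _ j → reflexive (hcat-↑ʳ y z Fin.zero j)
          v⊥ : HermDual R ι Code v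
          v⊥ = Equivalence.from (dual⇔ v) (≋-trans (⊕-cong y≋ (∙-congʳ z≋)) (⊖-inverseˡ _))

      closed : X ∙ X ᴴ ≋ ⊖ 𝟏 k → ∀ x → Code x → HermDual R ι Code x
      closed XXᴴ≋ x x∈ = Equivalence.from (dual⇔ x) (begin
        x₁ x ⊕ x₂ x ∙ X ᴴ             ≈⟨ ⊕-congˡ (∙-congʳ (Equivalence.to (code⇔ x) x∈)) ⟩
        x₁ x ⊕ (x₁ x ∙ X) ∙ X ᴴ       ≈⟨ ⊕-congˡ (≋-trans (∙-assoc (x₁ x) X (X ᴴ)) (∙-congˡ XXᴴ≋)) ⟩
        x₁ x ⊕ x₁ x ∙ ⊖ 𝟏 k           ≈⟨ ⊕-congˡ (∙-⊖𝟏 (x₁ x)) ⟩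
        x₁ x ⊕ ⊖ x₁ x                 ≈⟨ ⊖-inverseʳ (x₁ x) ⟩
        𝟎                             ∎)

      complete : X ᴴ ∙ X ≋ ⊖ 𝟏 k → ∀ x → HermDual R ι Code x → Code x
      complete XᴴX≋ x x⊥ = Equivalence.from (code⇔ x) (begin
        x₂ x                          ≈⟨ ⊖-involutive (x₂ x) ⟨
        ⊖ ⊖ x₂ x                      ≈⟨ ⊖-cong (∙-⊖𝟏 (x₂ x)) ⟨
        ⊖ (x₂ x ∙ ⊖ 𝟏 k)              ≈⟨ ⊖-cong (∙-congˡ XᴴX≋) ⟨
        ⊖ (x₂ x ∙ (X ᴴ ∙ X))          ≈⟨ ⊖-cong (∙-assoc (x₂ x) (X ᴴ) X) ⟨
        ⊖ ((x₂ x ∙ X ᴴ) ∙ X)          ≈⟨ ⊖-∙ (x₂ x ∙ X ᴴ) X ⟨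
        ⊖ (x₂ x ∙ X ᴴ) ∙ X            ≈⟨ ∙-congʳ (⊕-inverseˡ-unique (x₁ x) _ (Equivalence.to (dual⇔ x) x⊥)) ⟨
        x₁ x ∙ X                      ∎)

module Circulants {c ℓ} (R : CommutativeRing c ℓ) (ι : Involution R) (m : ℕ) (ν : CommutativeRing.Carrier R) where
  open CommutativeRing R
  open Sums R
  open Matrices R
  open Adjoint R ι
  open import Relation.Nullary.Decidable using (dec-true; dec-false)
  open import Data.Fin.Relation.Unary.Top using (view; ‵fromℕ; ‵inject₁)
  open import Data.Fin.Induction using (<-weakInduction)
  open import Data.Nat.DivMod using (m<n⇒m%n≡m; [m+n]%n≡m%n)
  open import Algebra.Properties.CommutativeSemigroup *-commutativeSemigroup using (x∙yz≈y∙xz)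

  N : ℕ
  N = suc m

  P : Mat R N N
  P = Pν R N ν

  last : Fin N
  last = Fin.fromℕ m

  P-inject₁ : ∀ (r : Fin m) j → P (Fin.inject₁ r) j ≡ δ R (toℕ (Fin.suc r)) (toℕ j)
  P-inject₁ r j rewrite Fin.toℕ-inject₁ r =
    ≡.cong (λ b → if b then (if does (toℕ j ℕ.≟ 0) then ν else 0#) else δ R (suc (toℕ r)) (toℕ j))
           (dec-false (suc (toℕ r) ℕ.≟ N) (ℕ.<⇒≢ (s≤s (Fin.toℕ<n r))))

  P-last : ∀ j → P last j ≡ (if does (toℕ j ℕ.≟ 0) then ν else 0#)
  P-last j rewrite Fin.toℕ-fromℕ m =
    ≡.cong (λ b → if b then (if does (toℕ j ℕ.≟ 0) then ν else 0#) else δ R N (toℕ j)) (dec-true (N ℕ.≟ N) ≡.refl)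

  P∙-inject₁ : ∀ (M : Mat R N N) r s → (P ∙ M) (Fin.inject₁ r) s ≈ M (Fin.suc r) s
  P∙-inject₁ M r s = trans (∑-cong {N} λ l → *-congʳ {M l s} (reflexive (P-inject₁ r l))) (∑-δˡ (λ l → M l s) (Fin.suc r))

  P∙-last : ∀ (M : Mat R N N) s → (P ∙ M) last s ≈ ν * M Fin.zero s
  P∙-last M s = trans (+-cong (*-congʳ (reflexive (P-last Fin.zero)))
                              (∑-zero {m} λ l → trans (*-congʳ (reflexive (P-last (Fin.suc l)))) (zeroˡ _)))
                      (+-identityʳ _)

  P-col-suc : ∀ l t → P l (Fin.suc t) ≈ δ R (toℕ l) (toℕ (Fin.inject₁ t))
  P-col-suc l t with view l
  ... | ‵fromℕ = reflexive (≡.trans (P-last (Fin.suc t)) (≡.sym (δ-≢ λ eq →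
          ℕ.<⇒≢ (Fin.toℕ<n t) (≡.sym (≡.trans (≡.sym (Fin.toℕ-fromℕ m)) (≡.trans eq (Fin.toℕ-inject₁ t)))))))
  ... | ‵inject₁ l' = reflexive (≡.trans (P-inject₁ l' (Fin.suc t))
                                  (≡.cong₂ (δ R) (≡.sym (Fin.toℕ-inject₁ l')) (≡.sym (Fin.toℕ-inject₁ t))))

  P-col-zero : ∀ l → P l Fin.zero ≈ δ R (toℕ l) (toℕ last) * ν
  P-col-zero l with view l
  ... | ‵fromℕ = trans (reflexive (P-last Fin.zero))
                   (trans (sym (*-identityˡ ν)) (*-congʳ (reflexive (≡.sym (δ-refl (toℕ last))))))
  ... | ‵inject₁ l' = trans (reflexive (P-inject₁ l' Fin.zero))
                        (trans (sym (zeroˡ ν)) (*-congʳ (reflexive (≡.sym (δ-≢ λ eq →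
                          ℕ.<⇒≢ (Fin.toℕ<n l') (≡.trans (≡.sym (Fin.toℕ-inject₁ l')) (≡.trans eq (Fin.toℕ-fromℕ m))))))))

  ∙P-suc : ∀ (M : Mat R N N) r t → (M ∙ P) r (Fin.suc t) ≈ M r (Fin.inject₁ t)
  ∙P-suc M r t = trans (∑-cong {N} λ l → *-congˡ {M r l} (P-col-suc l t)) (∑-δʳ (M r) (Fin.inject₁ t))

  ∙P-zero : ∀ (M : Mat R N N) r → (M ∙ P) r Fin.zero ≈ M r last * ν
  ∙P-zero M r = begin
    ∑ (λ l → M r l * P l Fin.zero)                 ≈⟨ ∑-cong {N} (λ l → trans (*-congˡ {M r l} (P-col-zero l)) (sym (*-assoc _ _ _))) ⟩
    ∑ (λ l → M r l * δ R (toℕ l) (toℕ last) * ν)   ≈⟨ ∑-*ʳ ν (λ l → M r l * δ R (toℕ l) (toℕ last)) ⟨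
    ∑ (λ l → M r l * δ R (toℕ l) (toℕ last)) * ν   ≈⟨ *-congʳ (∑-δʳ (M r) last) ⟩
    M r last * ν                                   ∎
    where open ≈-Reasoning

  record Commutes (M : Mat R N N) : Set ℓ where
    constructor commutes
    field ∙P≋P∙ : M ∙ P ≋ P ∙ M
  open Commutes public

  pow : ℕ → Mat R N N
  pow = matPow R P

  pow-commutes : ∀ {M} → Commutes M → ∀ k → pow k ∙ M ≋ M ∙ pow k
  pow-commutes {M} _ zero = ≋-trans (𝟏-∙ M) (≋-sym (∙-𝟏 M))
  pow-commutes {M} (commutes MP≋PM) (suc k) = begin
    (pow k ∙ P) ∙ M   ≈⟨ ∙-assoc (pow k) P M ⟩
    pow k ∙ (P ∙ M)   ≈⟨ ∙-congˡ {A = pow k} MP≋PM ⟨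
    pow k ∙ (M ∙ P)   ≈⟨ ∙-assoc (pow k) M P ⟨
    (pow k ∙ M) ∙ P   ≈⟨ ∙-congʳ {B = P} (pow-commutes {M} (commutes MP≋PM) k) ⟩
    (M ∙ pow k) ∙ P   ≈⟨ ∙-assoc M (pow k) P ⟩
    M ∙ (pow k ∙ P)   ∎
    where open ≋-Reasoning

  -- circ R ν v is definitionally lincomb v (λ i → pow (toℕ i)).
  circ-commutes : ∀ {M} → Commutes M → ∀ v → circ R ν v ∙ M ≋ M ∙ circ R ν v
  circ-commutes {M} MP≋PM v = ≋-trans (lincomb-∙ v F M)
    (≋-trans (lincomb-cong v λ i → pow-commutes {M} MP≋PM (toℕ i)) (≋-sym (∙-lincomb v M F)))
    where F = λ (i : Fin N) → pow (toℕ i)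

  pow-row₀ : ∀ k → k < N → ∀ s → pow k Fin.zero s ≈ δ R k (toℕ s)
  pow-row₀ zero _ s = refl
  pow-row₀ (suc k) (s≤s k<m) Fin.zero = trans (∙P-zero (pow k) Fin.zero)
    (trans (*-congʳ (pow-row₀ k (ℕ.m<n⇒m<1+n k<m) last))
      (trans (*-congʳ (reflexive (δ-≢ λ k≡ → ℕ.<⇒≢ k<m (≡.trans k≡ (Fin.toℕ-fromℕ m))))) (zeroˡ ν)))
  pow-row₀ (suc k) (s≤s k<m) (Fin.suc t) = trans (∙P-suc (pow k) Fin.zero t)
    (trans (pow-row₀ k (ℕ.m<n⇒m<1+n k<m) (Fin.inject₁ t)) (reflexive (≡.cong (δ R k) (Fin.toℕ-inject₁ t))))

  circ-row₀ : ∀ v s → circ R ν v Fin.zero s ≈ v s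
  circ-row₀ v s = trans (∑-cong {N} λ i → *-congˡ {v i} (pow-row₀ (toℕ i) (Fin.toℕ<n i) s)) (∑-δʳ v s)

  at-toℕ : ∀ (w : Vect R N) s → at R w (toℕ s) ≡ w s
  at-toℕ w s = ≡.cong w (Fin.toℕ-injective (≡.trans (Fin.toℕ-fromℕ< _) (m<n⇒m%n≡m (Fin.toℕ<n s))))

  -- Entry (a, b) of the ν-circulant with first row w.
  wrap : Vect R N → ℕ → ℕ → Carrier
  wrap w a b with a ℕ.≤? b
  ... | yes _ = at R w (b ∸ a)
  ... | no _ = ν * at R w (N ℕ.+ b ∸ a)

  wrap-≤ : ∀ w {a b} → a ≤ b → wrap w a b ≡ at R w (b ∸ a)
  wrap-≤ w {a} {b} a≤b with a ℕ.≤? b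
  ... | yes _ = ≡.refl
  ... | no a≰b = ⊥-elim (a≰b a≤b)

  wrap-> : ∀ w {a b} → b < a → wrap w a b ≡ ν * at R w (N ℕ.+ b ∸ a)
  wrap-> w {a} {b} b<a with a ℕ.≤? b
  ... | yes a≤b = ⊥-elim (ℕ.<⇒≱ b<a a≤b)
  ... | no _ = ≡.refl

  wrap-suc : ∀ w a b → wrap w (suc a) (suc b) ≡ wrap w a b
  wrap-suc w a b with a ℕ.≤? b
  ... | yes a≤b = wrap-≤ w (s≤s a≤b)
  ... | no a≰b = ≡.trans (wrap-> w (s≤s (ℕ.≰⇒> a≰b))) (≡.cong (λ k → ν * at R w (k ∸ suc a)) (ℕ.+-suc N b))

  wrap-cong : ∀ {w w'} → (∀ s → w s ≈ w' s) → ∀ a b → wrap w a b ≈ wrap w' a b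
  wrap-cong w≈ a b with a ℕ.≤? b
  ... | yes _ = w≈ _
  ... | no _ = *-congˡ (w≈ _)

  commutes⇒wrap : ∀ {M} → Commutes M → ∀ r s → M r s ≈ wrap (M Fin.zero) (toℕ r) (toℕ s)
  commutes⇒wrap {M} MP≋PM = <-weakInduction (λ r → ∀ s → M r s ≈ wrap w (toℕ r) (toℕ s)) base step
    where
      open ≈-Reasoning
      w = M Fin.zero

      base : ∀ s → M Fin.zero s ≈ wrap w 0 (toℕ s)
      base s = sym (reflexive (≡.trans (wrap-≤ w {b = toℕ s} z≤n) (at-toℕ w s)))

      step : ∀ r → (∀ s → M (Fin.inject₁ r) s ≈ wrap w (toℕ (Fin.inject₁ r)) (toℕ s)) →
             ∀ s → M (Fin.suc r) s ≈ wrap w (suc (toℕ r)) (toℕ s)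
      step r IH s = trans (sym (P∙-inject₁ M r s)) (trans (sym (entrywise (∙P≋P∙ MP≋PM) (Fin.inject₁ r) s)) (shifted s))
        where
          shifted : ∀ s → (M ∙ P) (Fin.inject₁ r) s ≈ wrap w (suc (toℕ r)) (toℕ s)
          shifted Fin.zero = begin
            (M ∙ P) (Fin.inject₁ r) Fin.zero          ≈⟨ ∙P-zero M _ ⟩
            M (Fin.inject₁ r) last * ν                 ≈⟨ *-congʳ (IH last) ⟩
            wrap w (toℕ (Fin.inject₁ r)) (toℕ last) * ν ≡⟨ ≡.cong₂ (λ a b → wrap w a b * ν) (Fin.toℕ-inject₁ r) (Fin.toℕ-fromℕ m) ⟩
            wrap w (toℕ r) m * ν                       ≡⟨ ≡.cong (_* ν) (wrap-≤ w (ℕ.<⇒≤ (Fin.toℕ<n r))) ⟩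
            at R w (m ∸ toℕ r) * ν                     ≈⟨ *-comm _ ν ⟩
            ν * at R w (m ∸ toℕ r)                     ≡⟨ ≡.cong (λ k → ν * at R w (k ∸ toℕ r)) (ℕ.+-identityʳ m) ⟨
            ν * at R w (N ℕ.+ 0 ∸ suc (toℕ r))         ≡⟨ wrap-> w {suc (toℕ r)} (s≤s z≤n) ⟨
            wrap w (suc (toℕ r)) 0                     ∎
          shifted (Fin.suc t) = trans (∙P-suc M _ t) (trans (IH (Fin.inject₁ t))
            (reflexive (≡.trans (≡.cong₂ (wrap w) (Fin.toℕ-inject₁ r) (Fin.toℕ-inject₁ t)) (≡.sym (wrap-suc w (toℕ r) (toℕ t))))))

  Commutes-circ : ∀ v → Commutes (circ R ν v)
  Commutes-circ v = commutes (circ-commutes (commutes {P} ≋-refl) v)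

  circ-wrap : ∀ v r s → circ R ν v r s ≈ wrap v (toℕ r) (toℕ s)
  circ-wrap v r s = trans (commutes⇒wrap (Commutes-circ v) r s) (wrap-cong (circ-row₀ v) (toℕ r) (toℕ s))

  commutes⇒circ : ∀ {M} → Commutes M → M ≋ circ R ν (M Fin.zero)
  commutes⇒circ MP≋PM = mk≋ λ r s → trans (commutes⇒wrap MP≋PM r s) (sym (circ-wrap _ r s))

  commutes-comm : ∀ {A B} → Commutes A → Commutes B → A ∙ B ≋ B ∙ A
  commutes-comm {A} {B} AP≋PA BP≋PB = begin
    A ∙ B                     ≈⟨ ∙-congʳ {B = B} (commutes⇒circ AP≋PA) ⟩
    circ R ν (A Fin.zero) ∙ B ≈⟨ circ-commutes BP≋PB (A Fin.zero) ⟩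
    B ∙ circ R ν (A Fin.zero) ≈⟨ ∙-congˡ {A = B} (commutes⇒circ AP≋PA) ⟨
    B ∙ A                     ∎
    where open ≋-Reasoning

  Commutes-∙ : ∀ {A B} → Commutes A → Commutes B → Commutes (A ∙ B)
  Commutes-∙ {A} {B} (commutes AP≋PA) (commutes BP≋PB) = commutes (begin
    (A ∙ B) ∙ P   ≈⟨ ∙-assoc A B P ⟩
    A ∙ (B ∙ P)   ≈⟨ ∙-congˡ {A = A} BP≋PB ⟩
    A ∙ (P ∙ B)   ≈⟨ ∙-assoc A P B ⟨
    (A ∙ P) ∙ B   ≈⟨ ∙-congʳ {B = B} AP≋PA ⟩
    (P ∙ A) ∙ B   ≈⟨ ∙-assoc P A B ⟩
    P ∙ (A ∙ B)   ∎)
    where open ≋-Reasoning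

  Commutes-⊕ : ∀ {A B} → Commutes A → Commutes B → Commutes (A ⊕ B)
  Commutes-⊕ {A} {B} (commutes AP≋PA) (commutes BP≋PB) =
    commutes (≋-trans (∙-distribʳ A B P) (≋-trans (⊕-cong AP≋PA BP≋PB) (≋-sym (∙-distribˡ P A B))))

  module Unitary (νν̄≈1 : ν * bar ν ≈ 1#) where
    P∙Pᴴ : P ∙ P ᴴ ≋ 𝟏 N
    P∙Pᴴ = mk≋ λ r s → entry r s
      where
        entry : ∀ r s → (P ∙ P ᴴ) r s ≈ δ R (toℕ r) (toℕ s)
        entry r s with view r
        ... | ‵inject₁ r' = trans (P∙-inject₁ (P ᴴ) r' s) (trans (bar-cong (P-col-suc s r'))
                              (trans (bar-δ (toℕ s) (toℕ (Fin.inject₁ r')))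
                              (reflexive (δ-sym (toℕ s) _))))
        ... | ‵fromℕ = trans (P∙-last (P ᴴ) s) (trans (*-congˡ (trans (bar-cong (P-col-zero s)) (bar-* _ _)))
                         (trans (*-congˡ (*-congʳ (bar-δ (toℕ s) (toℕ last)))) (trans (x∙yz≈y∙xz _ _ _)
                         (trans (*-congˡ νν̄≈1) (trans (*-identityʳ _) (reflexive (δ-sym (toℕ s) (toℕ last))))))))

    Pᴴ∙P : P ᴴ ∙ P ≋ 𝟏 N
    Pᴴ∙P = mk≋ entry
      where
        entry : ∀ r s → (P ᴴ ∙ P) r s ≈ δ R (toℕ r) (toℕ s)
        entry r (Fin.suc t) = trans (∙P-suc (P ᴴ) r t) (trans (bar-cong (reflexive (P-inject₁ t r)))
                                (trans (bar-δ (toℕ (Fin.suc t)) (toℕ r)) (reflexive (δ-sym _ (toℕ r)))))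
        entry Fin.zero Fin.zero = trans (∙P-zero (P ᴴ) Fin.zero)
          (trans (*-congʳ (bar-cong (reflexive (P-last Fin.zero)))) (trans (*-comm _ ν) νν̄≈1))
        entry (Fin.suc r) Fin.zero = trans (∙P-zero (P ᴴ) (Fin.suc r))
          (trans (*-congʳ (trans (bar-cong (reflexive (P-last (Fin.suc r)))) bar-0)) (zeroˡ ν))

    Commutes-ᴴ : ∀ {A} → Commutes A → Commutes (A ᴴ)
    Commutes-ᴴ {A} (commutes AP≋PA) = commutes (begin
      A ᴴ ∙ P         ≈⟨ ∙-congˡ {A = A ᴴ} (ᴴ-involutive P) ⟨
      A ᴴ ∙ P ᴴ ᴴ     ≈⟨ ᴴ-∙ (P ᴴ) A ⟨
      (P ᴴ ∙ A) ᴴ     ≈⟨ ᴴ-cong Pᴴ∙A≋A∙Pᴴ ⟩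
      (A ∙ P ᴴ) ᴴ     ≈⟨ ᴴ-∙ A (P ᴴ) ⟩
      P ᴴ ᴴ ∙ A ᴴ     ≈⟨ ∙-congʳ {B = A ᴴ} (ᴴ-involutive P) ⟩
      P ∙ A ᴴ         ∎)
      where
        open ≋-Reasoning
        open MonoidSolver N
        Pᴴ∙A≋A∙Pᴴ : P ᴴ ∙ A ≋ A ∙ P ᴴ
        Pᴴ∙A≋A∙Pᴴ = begin
          P ᴴ ∙ A                 ≈⟨ ∙-𝟏 (P ᴴ ∙ A) ⟨
          P ᴴ ∙ A ∙ 𝟏 N           ≈⟨ ∙-congˡ {A = P ᴴ ∙ A} P∙Pᴴ ⟨
          P ᴴ ∙ A ∙ (P ∙ P ᴴ)     ≈⟨ solve 3 (λ q a p → (q ⊙ a) ⊙ (p ⊙ q) ⊜ q ⊙ ((a ⊙ p) ⊙ q)) ≋-refl (P ᴴ) A P ⟩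
          P ᴴ ∙ ((A ∙ P) ∙ P ᴴ)   ≈⟨ ∙-congˡ {A = P ᴴ} (∙-congʳ {B = P ᴴ} AP≋PA) ⟩
          P ᴴ ∙ ((P ∙ A) ∙ P ᴴ)   ≈⟨ solve 3 (λ q a p → q ⊙ ((p ⊙ a) ⊙ q) ⊜ (q ⊙ p) ⊙ (a ⊙ q)) ≋-refl (P ᴴ) A P ⟩
          (P ᴴ ∙ P) ∙ (A ∙ P ᴴ)   ≈⟨ ∙-congʳ {B = A ∙ P ᴴ} Pᴴ∙P ⟩
          𝟏 N ∙ (A ∙ P ᴴ)         ≈⟨ 𝟏-∙ (A ∙ P ᴴ) ⟩
          A ∙ P ᴴ                 ∎

  at-+N : ∀ (w : Vect R N) k → at R w (k ℕ.+ N) ≡ at R w k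
  at-+N w k = ≡.cong w (Fin.toℕ-injective (≡.trans (Fin.toℕ-fromℕ< _)
                (≡.trans ([m+n]%n≡m%n k N) (≡.sym (Fin.toℕ-fromℕ< _)))))

  circ∙circᴴ-row₀ : ∀ v (j : Fin N) → (circ R ν v ∙ circ R ν v ᴴ) Fin.zero j ≈ Θ R v (conjV R ι v) (toℕ j) (bar ν)
  circ∙circᴴ-row₀ v j = begin
    ∑ (λ l → A Fin.zero l * bar (A j l))
      ≈⟨ ∑-cong {N} (λ l → *-cong (trans (circ-row₀ v l) (reflexive (≡.sym (at-toℕ v l)))) (bar-cong (circ-wrap v j l))) ⟩
    ∑ {N} (λ l → g (toℕ l))               ≈⟨ ∑≈ΣRange N g ⟩
    ΣRange R 0 N g                         ≡⟨ ≡.cong (λ n → ΣRange R 0 n g) (ℕ.m+[n∸m]≡n J≤N) ⟨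
    ΣRange R 0 (J ℕ.+ (N ∸ J)) g           ≈⟨ ΣRange-split 0 J (N ∸ J) g ⟩
    ΣRange R 0 J g + ΣRange R J (N ∸ J) g  ≈⟨ +-comm _ _ ⟩
    ΣRange R J (N ∸ J) g + ΣRange R 0 J g  ≈⟨ +-cong unwrapped wrapped ⟩
    ΣRange R 0 (N ∸ J) h + bar ν * ΣRange R (N ∸ J) J h ∎
    where
      open ≈-Reasoning
      A = circ R ν v
      J = toℕ j
      J≤N = ℕ.<⇒≤ (Fin.toℕ<n j)
      g h : ℕ → Carrier
      g i = at R v i * bar (wrap v J i)
      h i = at R v (i ℕ.+ J) * at R (conjV R ι v) i

      unwrapped : ΣRange R J (N ∸ J) g ≈ ΣRange R 0 (N ∸ J) h
      unwrapped = trans (ΣRange-shift 0 J (N ∸ J) g) (ΣRange-cong 0 (N ∸ J) λ k _ →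
        *-congˡ (bar-cong (reflexive (≡.trans (wrap-≤ v (ℕ.m≤n+m J k)) (≡.cong (at R v) (ℕ.m+n∸n≡m k J))))))

      wrapped : ΣRange R 0 J g ≈ bar ν * ΣRange R (N ∸ J) J h
      wrapped = sym (trans (ΣRange-*ˡ (bar ν) (N ∸ J) J h)
                   (trans (ΣRange-shift 0 (N ∸ J) J _) (ΣRange-cong 0 J λ k k<J → sym (term k k<J))))
        where
          term : ∀ k → k < J → g k ≈ bar ν * h (k ℕ.+ (N ∸ J))
          term k k<J = begin
            at R v k * bar (wrap v J k)                          ≡⟨ ≡.cong (λ x → at R v k * bar x) (wrap-> v k<J) ⟩
            at R v k * bar (ν * at R v (N ℕ.+ k ∸ J))            ≈⟨ *-congˡ (bar-* ν _) ⟩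
            at R v k * (bar ν * bar (at R v (N ℕ.+ k ∸ J)))      ≈⟨ x∙yz≈y∙xz _ _ _ ⟩
            bar ν * (at R v k * bar (at R v (N ℕ.+ k ∸ J)))      ≡⟨ ≡.cong₂ (λ a b → bar ν * (a * bar b)) wrapsAround (≡.cong (at R v) shifted) ⟩
            bar ν * h (k ℕ.+ (N ∸ J))                            ∎
            where
              wrapsAround : at R v k ≡ at R v (k ℕ.+ (N ∸ J) ℕ.+ J)
              wrapsAround = ≡.trans (≡.sym (at-+N v k))
                (≡.cong (at R v) (≡.sym (≡.trans (ℕ.+-assoc k (N ∸ J) J) (≡.cong (k ℕ.+_) (ℕ.m∸n+n≡m J≤N)))))
              shifted : N ℕ.+ k ∸ J ≡ k ℕ.+ (N ∸ J)
              shifted = ≡.trans (≡.cong (_∸ J) (ℕ.+-comm N k)) (ℕ.+-∸-assoc k J≤N)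

  at-< : ∀ (w : Vect R N) {k} (k<N : k < N) → at R w k ≡ w (fromℕ< k<N)
  at-< w k<N = ≡.cong w (Fin.toℕ-injective (≡.trans (Fin.toℕ-fromℕ< _)
                 (≡.trans (m<n⇒m%n≡m k<N) (≡.sym (Fin.toℕ-fromℕ< k<N)))))

  wrap-scalar : ∀ {w} x → (∀ s → w s ≈ x * δ R 0 (toℕ s)) →
                ∀ (r s : Fin N) → wrap w (toℕ r) (toℕ s) ≈ x * δ R (toℕ r) (toℕ s)
  wrap-scalar {w} x w≈ r s with toℕ r ℕ.≤? toℕ s
  ... | yes r≤s = trans (reflexive (at-< w s∸r<N)) (trans (w≈ _) (*-congˡ (reflexive
                    (≡.trans (≡.cong (δ R 0) (Fin.toℕ-fromℕ< s∸r<N)) (δ₀-∸ r≤s)))))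
    where
      s∸r<N = ℕ.≤-<-trans (ℕ.m∸n≤m (toℕ s) (toℕ r)) (Fin.toℕ<n s)
      δ₀-∸ : ∀ {a b} → a ≤ b → δ R 0 (b ∸ a) ≡ δ R a b
      δ₀-∸ {a} {b} a≤b with a ℕ.≟ b
      ... | yes ≡.refl = ≡.trans (≡.cong (δ R 0) (ℕ.n∸n≡0 a)) (≡.sym (δ-refl a))
      ... | no a≢b = ≡.trans (δ-≢ λ 0≡ → a≢b (ℕ.≤-antisym a≤b (ℕ.m∸n≡0⇒m≤n (≡.sym 0≡)))) (≡.sym (δ-≢ a≢b))
  ... | no r≰s = begin
    ν * at R w (N ℕ.+ toℕ s ∸ toℕ r)                   ≡⟨ ≡.cong (ν *_) (at-< w k<N) ⟩
    ν * w (fromℕ< k<N)                                  ≈⟨ *-congˡ (trans (w≈ _) (*-congˡ (reflexive (δ-≢ k≢0)))) ⟩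
    ν * (x * 0#)                                        ≈⟨ trans (*-congˡ (zeroʳ x)) (zeroʳ ν) ⟩
    0#                                                  ≈⟨ zeroʳ x ⟨
    x * 0#                                              ≡⟨ ≡.cong (x *_) (δ-≢ λ r≡s → r≰s (ℕ.≤-reflexive r≡s)) ⟨
    x * δ R (toℕ r) (toℕ s)                             ∎
    where
      open ≈-Reasoning
      s<r = ℕ.≰⇒> r≰s
      r≤N = ℕ.<⇒≤ (Fin.toℕ<n r)
      k≡ : N ℕ.+ toℕ s ∸ toℕ r ≡ toℕ s ℕ.+ (N ∸ toℕ r)
      k≡ = ≡.trans (≡.cong (_∸ toℕ r) (ℕ.+-comm N (toℕ s))) (ℕ.+-∸-assoc (toℕ s) r≤N)
      k<N : N ℕ.+ toℕ s ∸ toℕ r < N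
      k<N = ≡.subst (_< N) (≡.sym k≡)
              (≡.subst (toℕ s ℕ.+ (N ∸ toℕ r) <_) (ℕ.m+[n∸m]≡n r≤N) (ℕ.+-monoˡ-< (N ∸ toℕ r) s<r))
      k≢0 : 0 ≢ toℕ (fromℕ< k<N)
      k≢0 0≡ = ℕ.<⇒≱ (ℕ.<-≤-trans (Fin.toℕ<n r) (ℕ.m≤m+n N (toℕ s)))
                 (ℕ.m∸n≡0⇒m≤n (≡.trans (≡.sym (Fin.toℕ-fromℕ< k<N)) (≡.sym 0≡)))

  FirstRowCondition : Carrier → Mat R N N → Set ℓ
  FirstRowCondition x H =
    H Fin.zero Fin.zero ≈ x × (∀ (j : Fin N) → 1 ≤ toℕ j → toℕ j ≤ N / 2 → H Fin.zero j ≈ 0#)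

  scalar⇔firstRow : ∀ {H} x → Commutes H → H ᴴ ≋ H → (H ≋ x • 𝟏 N ⇔ FirstRowCondition x H)
  scalar⇔firstRow {H} x HP≋PH Hᴴ≋H = mk⇔ to from
    where
      x•δ₀₀ : x * δ R 0 0 ≈ x
      x•δ₀₀ = trans (*-congˡ (reflexive (δ-refl 0))) (*-identityʳ x)

      x•δ₀ⱼ : ∀ {j} → 1 ≤ j → x * δ R 0 j ≈ 0#
      x•δ₀ⱼ 1≤j = trans (*-congˡ (reflexive (δ-≢ (ℕ.<⇒≢ 1≤j)))) (zeroʳ x)

      to : H ≋ x • 𝟏 N → FirstRowCondition x H
      to H≋ = trans (entrywise H≋ Fin.zero Fin.zero) x•δ₀₀ ,
              λ j 1≤j _ → trans (entrywise H≋ Fin.zero j) (x•δ₀ⱼ 1≤j)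

      from : FirstRowCondition x H → H ≋ x • 𝟏 N
      from (h₀₀ , h₀ⱼ) = mk≋ λ r s → trans (commutes⇒wrap HP≋PH r s) (wrap-scalar x row₀ r s)
        where
          w = H Fin.zero

          -- Hermitian symmetry and the entry formula give w s ≈ bar (ν * w (N − s)).
          mirrored : ∀ s → 1 ≤ toℕ s → ¬ toℕ s ≤ N / 2 → w s ≈ 0#
          mirrored s 1≤s s≰ = begin
            H Fin.zero s                              ≈⟨ entrywise Hᴴ≋H Fin.zero s ⟨
            bar (H s Fin.zero)                        ≈⟨ bar-cong (commutes⇒wrap HP≋PH s Fin.zero) ⟩
            bar (wrap w (toℕ s) 0)                    ≡⟨ ≡.cong bar (≡.trans (wrap-> w 1≤s) (≡.cong (ν *_) (at-< w k<N))) ⟩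
            bar (ν * w (fromℕ< k<N))                  ≈⟨ bar-cong (*-congˡ (h₀ⱼ (fromℕ< k<N)
                                                            (≡.subst (1 ≤_) k≡ 1≤k) (≡.subst (_≤ N / 2) k≡ k≤))) ⟩
            bar (ν * 0#)                              ≈⟨ trans (bar-cong (zeroʳ ν)) bar-0 ⟩
            0#                                        ∎
            where
              open ≈-Reasoning
              k = N ℕ.+ 0 ∸ toℕ s
              k≡N∸s : k ≡ N ∸ toℕ s
              k≡N∸s = ≡.cong (_∸ toℕ s) (ℕ.+-identityʳ N)
              k<N : k < N
              k<N = ≡.subst (_< N) (≡.sym k≡N∸s) (ℕ.∸-monoʳ-< 1≤s (ℕ.<⇒≤ (Fin.toℕ<n s)))
              k≡ : N ∸ toℕ s ≡ toℕ (fromℕ< k<N)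
              k≡ = ≡.sym (≡.trans (Fin.toℕ-fromℕ< k<N) k≡N∸s)
              1≤k = ℕ.m<n⇒0<n∸m (Fin.toℕ<n s)
              k≤ = ≰half⇒∸≤half (Fin.toℕ<n s) s≰

          row₀ : ∀ s → w s ≈ x * δ R 0 (toℕ s)
          row₀ Fin.zero = trans h₀₀ (sym x•δ₀₀)
          row₀ s@(Fin.suc _) with toℕ s ℕ.≤? N / 2
          ... | yes s≤ = trans (h₀ⱼ s (s≤s z≤n) s≤) (sym (x•δ₀ⱼ {toℕ s} (s≤s z≤n)))
          ... | no s≰ = trans (mirrored s (s≤s z≤n) s≰) (sym (x•δ₀ⱼ {toℕ s} (s≤s z≤n)))

  firstRow⇔ : ∀ {H} x (θ : ℕ → Carrier) → (∀ j → H Fin.zero j ≈ θ (toℕ j)) →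
              FirstRowCondition x H ⇔ (θ 0 ≈ x × (∀ j → 1 ≤ j → j ≤ N / 2 → θ j ≈ 0#))
  firstRow⇔ {H} x θ row≈θ = mk⇔
    (λ (h₀₀ , h₀ⱼ) → trans (sym (row≈θ Fin.zero)) h₀₀ , λ j → fromFin h₀ⱼ j)
    (λ (θ₀ , θⱼ) → trans (row≈θ Fin.zero) θ₀ , λ j 1≤j j≤ → trans (row≈θ j) (θⱼ (toℕ j) 1≤j j≤))
    where
      fromFin : (∀ (j : Fin N) → 1 ≤ toℕ j → toℕ j ≤ N / 2 → H Fin.zero j ≈ 0#) →
                ∀ j → 1 ≤ j → j ≤ N / 2 → θ j ≈ 0#
      fromFin h₀ⱼ j 1≤j j≤ = trans (reflexive (≡.cong θ (≡.sym toℕj'≡j)))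
        (trans (sym (row≈θ j')) (h₀ⱼ j' (≡.subst (1 ≤_) (≡.sym toℕj'≡j) 1≤j) (≡.subst (_≤ N / 2) (≡.sym toℕj'≡j) j≤)))
        where
          j<N = ≤half⇒< (s≤s z≤n) j≤
          j' = fromℕ< j<N
          toℕj'≡j = Fin.toℕ-fromℕ< j<N

module NegatedUnitaryBlock {c ℓ} (R : CommutativeRing c ℓ) (ι : Involution R) {n : ℕ} where
  open Matrices R
  open Adjoint R ι using (_ᴴ; ᴴ-cong; ᴴ-∙; ᴴ-involutive; ⊖ᴴ; block-ᴴ; IsNegatedUnitary)
  open ≋-Reasoning
  open MonoidSolver n

  record CommutingNormal (U V : Mat R n n) : Set ℓ where
    field
      U-normal : U ∙ U ᴴ ≋ U ᴴ ∙ U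
      V-normal : V ∙ V ᴴ ≋ V ᴴ ∙ V
      U∙V : U ∙ V ≋ V ∙ U
      U∙Vᴴ : U ∙ V ᴴ ≋ V ᴴ ∙ U
      Uᴴ∙V : U ᴴ ∙ V ≋ V ∙ U ᴴ
      Uᴴ∙Vᴴ : U ᴴ ∙ V ᴴ ≋ V ᴴ ∙ U ᴴ

  ⊖ᴴ-∙-⊖ : (X Y : Mat R n n) → (⊖ X) ᴴ ∙ ⊖ Y ≋ X ᴴ ∙ Y
  ⊖ᴴ-∙-⊖ X Y = ≋-trans (∙-congʳ {B = ⊖ Y} (⊖ᴴ X)) (⊖-∙-⊖ (X ᴴ) Y)

  ⊖-∙-⊖ᴴ : (X Y : Mat R n n) → ⊖ X ∙ (⊖ Y) ᴴ ≋ X ∙ Y ᴴ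
  ⊖-∙-⊖ᴴ X Y = ≋-trans (∙-congˡ {A = ⊖ X} (⊖ᴴ Y)) (⊖-∙-⊖ X (Y ᴴ))

  ∙-⊖ᴴ : (X Y : Mat R n n) → X ∙ (⊖ Y) ᴴ ≋ ⊖ (X ∙ Y ᴴ)
  ∙-⊖ᴴ X Y = ≋-trans (∙-congˡ {A = X} (⊖ᴴ Y)) (∙-⊖ X (Y ᴴ))

  ⊖ᴴ-∙ : (X Y : Mat R n n) → (⊖ X) ᴴ ∙ Y ≋ ⊖ (X ᴴ ∙ Y)
  ⊖ᴴ-∙ X Y = ≋-trans (∙-congʳ {B = Y} (⊖ᴴ X)) (⊖-∙ (X ᴴ) Y)

  ᴴ-∙ʳ : (X K Y : Mat R n n) → (X ∙ K) ᴴ ∙ Y ≋ K ᴴ ∙ (X ᴴ ∙ Y)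
  ᴴ-∙ʳ X K Y = ≋-trans (∙-congʳ {B = Y} (ᴴ-∙ X K)) (∙-assoc (K ᴴ) (X ᴴ) Y)

  ∙-∙ᴴ : (X K Y : Mat R n n) → (X ∙ K) ∙ (Y ∙ K) ᴴ ≋ X ∙ (K ∙ K ᴴ) ∙ Y ᴴ
  ∙-∙ᴴ X K Y = ≋-trans (∙-congˡ {A = X ∙ K} (ᴴ-∙ Y K))
    (solve 4 (λ x k kᴴ yᴴ → (x ⊙ k) ⊙ (kᴴ ⊙ yᴴ) ⊜ (x ⊙ (k ⊙ kᴴ)) ⊙ yᴴ) ≋-refl X K (K ᴴ) (Y ᴴ))

  module _ (U V K : Mat R n n) where
    ξ : Mat R (n ℕ.+ n) (n ℕ.+ n)
    ξ = block R (⊖ (U ∙ K)) (⊖ V ᴴ) (V ∙ K) (⊖ U ᴴ)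

    S : Mat R n n
    S = U ∙ U ᴴ ⊕ V ∙ V ᴴ

    module _ (UV-normal : CommutingNormal U V) where
      open CommutingNormal UV-normal

      ξᴴ∙ξ≋ : ξ ᴴ ∙ ξ ≋ block R (K ᴴ ∙ S ∙ K) 𝟎 𝟎 S
      ξᴴ∙ξ≋ = ≋-trans (∙-congʳ {B = ξ} (block-ᴴ (⊖ (U ∙ K)) (⊖ V ᴴ) (V ∙ K) (⊖ U ᴴ)))
        (≋-trans (block-∙ ((⊖ (U ∙ K)) ᴴ) ((V ∙ K) ᴴ) ((⊖ V ᴴ) ᴴ) ((⊖ U ᴴ) ᴴ) (⊖ (U ∙ K)) (⊖ V ᴴ) (V ∙ K) (⊖ U ᴴ))
                 (block-cong ≋₁₁ ≋₁₂ ≋₂₁ ≋₂₂))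
        where
          ≋₁₁ : (⊖ (U ∙ K)) ᴴ ∙ ⊖ (U ∙ K) ⊕ (V ∙ K) ᴴ ∙ (V ∙ K) ≋ K ᴴ ∙ S ∙ K
          ≋₁₁ = begin
            (⊖ (U ∙ K)) ᴴ ∙ ⊖ (U ∙ K) ⊕ (V ∙ K) ᴴ ∙ (V ∙ K)    ≈⟨ ⊕-cong (⊖ᴴ-∙-⊖ (U ∙ K) (U ∙ K)) ≋-refl ⟩
            (U ∙ K) ᴴ ∙ (U ∙ K) ⊕ (V ∙ K) ᴴ ∙ (V ∙ K)          ≈⟨ ⊕-cong (sandwich U) (sandwich V) ⟩
            K ᴴ ∙ (U ᴴ ∙ U) ∙ K ⊕ K ᴴ ∙ (V ᴴ ∙ V) ∙ K          ≈⟨ ∙-distribʳ _ _ K ⟨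
            (K ᴴ ∙ (U ᴴ ∙ U) ⊕ K ᴴ ∙ (V ᴴ ∙ V)) ∙ K            ≈⟨ ∙-congʳ {B = K} (∙-distribˡ (K ᴴ) _ _) ⟨
            K ᴴ ∙ (U ᴴ ∙ U ⊕ V ᴴ ∙ V) ∙ K                      ≈⟨ ∙-congʳ {B = K} (∙-congˡ {A = K ᴴ} (⊕-cong U-normal V-normal)) ⟨
            K ᴴ ∙ S ∙ K                                        ∎
            where
              sandwich : ∀ X → (X ∙ K) ᴴ ∙ (X ∙ K) ≋ K ᴴ ∙ (X ᴴ ∙ X) ∙ K
              sandwich X = ≋-trans (ᴴ-∙ʳ X K (X ∙ K))
                (solve 4 (λ kᴴ xᴴ x k → kᴴ ⊙ (xᴴ ⊙ (x ⊙ k)) ⊜ (kᴴ ⊙ (xᴴ ⊙ x)) ⊙ k) ≋-refl (K ᴴ) (X ᴴ) X K)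
          ≋₁₂ : (⊖ (U ∙ K)) ᴴ ∙ ⊖ V ᴴ ⊕ (V ∙ K) ᴴ ∙ ⊖ U ᴴ ≋ 𝟎
          ≋₁₂ = begin
            (⊖ (U ∙ K)) ᴴ ∙ ⊖ V ᴴ ⊕ (V ∙ K) ᴴ ∙ ⊖ U ᴴ          ≈⟨ ⊕-cong (⊖ᴴ-∙-⊖ (U ∙ K) (V ᴴ)) (∙-⊖ ((V ∙ K) ᴴ) (U ᴴ)) ⟩
            (U ∙ K) ᴴ ∙ V ᴴ ⊕ ⊖ ((V ∙ K) ᴴ ∙ U ᴴ)              ≈⟨ ⊕-cong (ᴴ-∙ʳ U K (V ᴴ)) (⊖-cong (ᴴ-∙ʳ V K (U ᴴ))) ⟩
            K ᴴ ∙ (U ᴴ ∙ V ᴴ) ⊕ ⊖ (K ᴴ ∙ (V ᴴ ∙ U ᴴ))          ≈⟨ ⊕-congˡ (⊖-cong (∙-congˡ {A = K ᴴ} Uᴴ∙Vᴴ)) ⟨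
            K ᴴ ∙ (U ᴴ ∙ V ᴴ) ⊕ ⊖ (K ᴴ ∙ (U ᴴ ∙ V ᴴ))          ≈⟨ ⊖-inverseʳ _ ⟩
            𝟎                                                  ∎
          ≋₂₁ : (⊖ V ᴴ) ᴴ ∙ ⊖ (U ∙ K) ⊕ (⊖ U ᴴ) ᴴ ∙ (V ∙ K) ≋ 𝟎
          ≋₂₁ = begin
            (⊖ V ᴴ) ᴴ ∙ ⊖ (U ∙ K) ⊕ (⊖ U ᴴ) ᴴ ∙ (V ∙ K)        ≈⟨ ⊕-cong (⊖ᴴ-∙-⊖ (V ᴴ) (U ∙ K)) (⊖ᴴ-∙ (U ᴴ) (V ∙ K)) ⟩
            V ᴴ ᴴ ∙ (U ∙ K) ⊕ ⊖ (U ᴴ ᴴ ∙ (V ∙ K))              ≈⟨ ⊕-cong (∙-congʳ {B = U ∙ K} (ᴴ-involutive V))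
                                                                      (⊖-cong (∙-congʳ {B = V ∙ K} (ᴴ-involutive U))) ⟩
            V ∙ (U ∙ K) ⊕ ⊖ (U ∙ (V ∙ K))                      ≈⟨ ⊕-congʳ swapped ⟩
            U ∙ (V ∙ K) ⊕ ⊖ (U ∙ (V ∙ K))                      ≈⟨ ⊖-inverseʳ _ ⟩
            𝟎                                                  ∎
            where
              swapped : V ∙ (U ∙ K) ≋ U ∙ (V ∙ K)
              swapped = ≋-trans (≋-sym (∙-assoc V U K)) (≋-trans (∙-congʳ {B = K} (≋-sym U∙V)) (∙-assoc U V K))
          ≋₂₂ : (⊖ V ᴴ) ᴴ ∙ ⊖ V ᴴ ⊕ (⊖ U ᴴ) ᴴ ∙ ⊖ U ᴴ ≋ S
          ≋₂₂ = begin
            (⊖ V ᴴ) ᴴ ∙ ⊖ V ᴴ ⊕ (⊖ U ᴴ) ᴴ ∙ ⊖ U ᴴ              ≈⟨ ⊕-cong (⊖ᴴ-∙-⊖ (V ᴴ) (V ᴴ)) (⊖ᴴ-∙-⊖ (U ᴴ) (U ᴴ)) ⟩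
            V ᴴ ᴴ ∙ V ᴴ ⊕ U ᴴ ᴴ ∙ U ᴴ                          ≈⟨ ⊕-cong (∙-congʳ {B = V ᴴ} (ᴴ-involutive V))
                                                                      (∙-congʳ {B = U ᴴ} (ᴴ-involutive U)) ⟩
            V ∙ V ᴴ ⊕ U ∙ U ᴴ                                  ≈⟨ ⊕-comm _ _ ⟩
            S                                                  ∎

      ξ∙ξᴴ≋ : K ∙ K ᴴ ≋ 𝟏 n → ξ ∙ ξ ᴴ ≋ block R S 𝟎 𝟎 S
      ξ∙ξᴴ≋ K∙Kᴴ≋𝟏 = ≋-trans (∙-congˡ {A = ξ} (block-ᴴ (⊖ (U ∙ K)) (⊖ V ᴴ) (V ∙ K) (⊖ U ᴴ)))
        (≋-trans (block-∙ (⊖ (U ∙ K)) (⊖ V ᴴ) (V ∙ K) (⊖ U ᴴ) ((⊖ (U ∙ K)) ᴴ) ((V ∙ K) ᴴ) ((⊖ V ᴴ) ᴴ) ((⊖ U ᴴ) ᴴ))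
                 (block-cong ≋₁₁ ≋₁₂ ≋₂₁ ≋₂₂))
        where
          unitary : ∀ (X Y : Mat R n n) → (X ∙ K) ∙ (Y ∙ K) ᴴ ≋ X ∙ Y ᴴ
          unitary X Y = ≋-trans (∙-∙ᴴ X K Y) (∙-congʳ {B = Y ᴴ} (≋-trans (∙-congˡ {A = X} K∙Kᴴ≋𝟏) (∙-𝟏 X)))
          ᴴᴴ : ∀ (X Y : Mat R n n) → X ∙ Y ᴴ ᴴ ≋ X ∙ Y
          ᴴᴴ X Y = ∙-congˡ {A = X} (ᴴ-involutive Y)

          ≋₁₁ : ⊖ (U ∙ K) ∙ (⊖ (U ∙ K)) ᴴ ⊕ ⊖ V ᴴ ∙ (⊖ V ᴴ) ᴴ ≋ S
          ≋₁₁ = begin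
            ⊖ (U ∙ K) ∙ (⊖ (U ∙ K)) ᴴ ⊕ ⊖ V ᴴ ∙ (⊖ V ᴴ) ᴴ      ≈⟨ ⊕-cong (⊖-∙-⊖ᴴ (U ∙ K) (U ∙ K)) (⊖-∙-⊖ᴴ (V ᴴ) (V ᴴ)) ⟩
            (U ∙ K) ∙ (U ∙ K) ᴴ ⊕ V ᴴ ∙ V ᴴ ᴴ                  ≈⟨ ⊕-cong (unitary U U) (ᴴᴴ (V ᴴ) V) ⟩
            U ∙ U ᴴ ⊕ V ᴴ ∙ V                                  ≈⟨ ⊕-congˡ V-normal ⟨
            S                                                  ∎
          ≋₁₂ : ⊖ (U ∙ K) ∙ (V ∙ K) ᴴ ⊕ ⊖ V ᴴ ∙ (⊖ U ᴴ) ᴴ ≋ 𝟎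
          ≋₁₂ = begin
            ⊖ (U ∙ K) ∙ (V ∙ K) ᴴ ⊕ ⊖ V ᴴ ∙ (⊖ U ᴴ) ᴴ          ≈⟨ ⊕-cong (⊖-∙ (U ∙ K) ((V ∙ K) ᴴ)) (⊖-∙-⊖ᴴ (V ᴴ) (U ᴴ)) ⟩
            ⊖ ((U ∙ K) ∙ (V ∙ K) ᴴ) ⊕ V ᴴ ∙ U ᴴ ᴴ              ≈⟨ ⊕-cong (⊖-cong (unitary U V)) (ᴴᴴ (V ᴴ) U) ⟩
            ⊖ (U ∙ V ᴴ) ⊕ V ᴴ ∙ U                              ≈⟨ ⊕-congʳ (⊖-cong U∙Vᴴ) ⟩
            ⊖ (V ᴴ ∙ U) ⊕ V ᴴ ∙ U                              ≈⟨ ⊖-inverseˡ _ ⟩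
            𝟎                                                  ∎
          ≋₂₁ : (V ∙ K) ∙ (⊖ (U ∙ K)) ᴴ ⊕ ⊖ U ᴴ ∙ (⊖ V ᴴ) ᴴ ≋ 𝟎
          ≋₂₁ = begin
            (V ∙ K) ∙ (⊖ (U ∙ K)) ᴴ ⊕ ⊖ U ᴴ ∙ (⊖ V ᴴ) ᴴ        ≈⟨ ⊕-cong (∙-⊖ᴴ (V ∙ K) (U ∙ K)) (⊖-∙-⊖ᴴ (U ᴴ) (V ᴴ)) ⟩
            ⊖ ((V ∙ K) ∙ (U ∙ K) ᴴ) ⊕ U ᴴ ∙ V ᴴ ᴴ              ≈⟨ ⊕-cong (⊖-cong (unitary V U)) (ᴴᴴ (U ᴴ) V) ⟩
            ⊖ (V ∙ U ᴴ) ⊕ U ᴴ ∙ V                              ≈⟨ ⊕-congʳ (⊖-cong Uᴴ∙V) ⟨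
            ⊖ (U ᴴ ∙ V) ⊕ U ᴴ ∙ V                              ≈⟨ ⊖-inverseˡ _ ⟩
            𝟎                                                  ∎
          ≋₂₂ : (V ∙ K) ∙ (V ∙ K) ᴴ ⊕ ⊖ U ᴴ ∙ (⊖ U ᴴ) ᴴ ≋ S
          ≋₂₂ = begin
            (V ∙ K) ∙ (V ∙ K) ᴴ ⊕ ⊖ U ᴴ ∙ (⊖ U ᴴ) ᴴ            ≈⟨ ⊕-cong (unitary V V) (⊖-∙-⊖ᴴ (U ᴴ) (U ᴴ)) ⟩
            V ∙ V ᴴ ⊕ U ᴴ ∙ U ᴴ ᴴ                              ≈⟨ ⊕-congˡ (ᴴᴴ (U ᴴ) U) ⟩
            V ∙ V ᴴ ⊕ U ᴴ ∙ U                                  ≈⟨ ⊕-congˡ U-normal ⟨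
            V ∙ V ᴴ ⊕ U ∙ U ᴴ                                  ≈⟨ ⊕-comm _ _ ⟩
            S                                                  ∎

      private
        sandwich-⊖𝟏 : K ᴴ ∙ ⊖ 𝟏 n ∙ K ≋ ⊖ (K ᴴ ∙ K)
        sandwich-⊖𝟏 = ≋-trans (∙-congʳ {B = K} (∙-⊖𝟏 (K ᴴ))) (⊖-∙ (K ᴴ) K)

      ξᴴ∙ξ≋-𝟏⇒ : ξ ᴴ ∙ ξ ≋ ⊖ 𝟏 (n ℕ.+ n) → S ≋ ⊖ 𝟏 n × K ᴴ ∙ K ≋ 𝟏 n
      ξᴴ∙ξ≋-𝟏⇒ ξᴴξ≋ with block-injective (≋-trans (≋-sym ξᴴ∙ξ≋) (≋-trans ξᴴξ≋ (⊖𝟏-block n n)))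
      ... | KᴴSK≋ , _ , _ , S≋ = S≋ , ⊖-injective (begin
        ⊖ (K ᴴ ∙ K)        ≈⟨ sandwich-⊖𝟏 ⟨
        K ᴴ ∙ ⊖ 𝟏 n ∙ K    ≈⟨ ∙-congʳ {B = K} (∙-congˡ {A = K ᴴ} S≋) ⟨
        K ᴴ ∙ S ∙ K        ≈⟨ KᴴSK≋ ⟩
        ⊖ 𝟏 n              ∎)

      ξ-negatedUnitary : S ≋ ⊖ 𝟏 n → K ∙ K ᴴ ≋ 𝟏 n → K ᴴ ∙ K ≋ 𝟏 n → IsNegatedUnitary ξ
      ξ-negatedUnitary S≋ KKᴴ≋ KᴴK≋ =
        ≋-trans (ξ∙ξᴴ≋ KKᴴ≋) (≋-trans (block-cong S≋ ≋-refl ≋-refl S≋) (≋-sym (⊖𝟏-block n n))) ,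
        ≋-trans ξᴴ∙ξ≋ (≋-trans (block-cong KᴴSK≋ ≋-refl ≋-refl S≋) (≋-sym (⊖𝟏-block n n)))
        where
          KᴴSK≋ : K ᴴ ∙ S ∙ K ≋ ⊖ 𝟏 n
          KᴴSK≋ = ≋-trans (∙-congʳ {B = K} (∙-congˡ {A = K ᴴ} S≋)) (≋-trans sandwich-⊖𝟏 (⊖-cong KᴴK≋))

module ExchangeMatrix {c ℓ} (R : CommutativeRing c ℓ) (ι : Involution R) (n : ℕ) where
  open CommutativeRing R
  open Sums R
  open Matrices R
  open Adjoint R ι using (_ᴴ; bar-δ)

  J : Mat R n n
  J = Jₙ R n

  Jᴴ≋J : J ᴴ ≋ J
  Jᴴ≋J = mk≋ λ i j → trans (bar-δ (toℕ j ℕ.+ toℕ i) (n ∸ 1))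
                           (reflexive (≡.cong (λ k → δ R k (n ∸ 1)) (ℕ.+-comm (toℕ j) (toℕ i))))

  J∙J≋𝟏 : J ∙ J ≋ 𝟏 n
  J∙J≋𝟏 = mk≋ λ i j → begin
    ∑ (λ l → J i l * J l j)   ≈⟨ ∑-single (λ l → J i l * J l j) (l₀ i)
                                   (λ l l≢ → trans (*-congʳ (reflexive (δ-≢ (l≢ ∘ solves i l)))) (zeroˡ _)) ⟩
    J i (l₀ i) * J (l₀ i) j   ≈⟨ *-congʳ (reflexive (≡.trans (≡.cong (λ k → δ R (toℕ i ℕ.+ k) (n ∸ 1)) (l₀-toℕ i))
                                                           (δ-refl' (ℕ.m+[n∸m]≡n (i≤ i))))) ⟩
    1# * J (l₀ i) j           ≈⟨ *-identityˡ _ ⟩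
    δ R (toℕ (l₀ i) ℕ.+ toℕ j) (n ∸ 1) ≡⟨ ≡.cong (λ k → δ R (k ℕ.+ toℕ j) (n ∸ 1)) (l₀-toℕ i) ⟩
    δ R (n ∸ 1 ∸ toℕ i ℕ.+ toℕ j) (n ∸ 1) ≡⟨ reflected (toℕ i) (toℕ j) (i≤ i) ⟩
    δ R (toℕ i) (toℕ j)       ∎
    where
      open ≈-Reasoning
      i≤ : (i : Fin n) → toℕ i ≤ n ∸ 1
      i≤ i = ℕ.<⇒≤pred (Fin.toℕ<n i)
      l₀< : (i : Fin n) → n ∸ 1 ∸ toℕ i < n
      l₀< i = ℕ.≤-<-trans (ℕ.m∸n≤m (n ∸ 1) (toℕ i))
                (ℕ.∸-monoʳ-< {n} {1} {0} (s≤s z≤n) (ℕ.≤-trans (s≤s z≤n) (Fin.toℕ<n i)))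
      l₀ : Fin n → Fin n
      l₀ i = fromℕ< (l₀< i)
      l₀-toℕ : ∀ i → toℕ (l₀ i) ≡ n ∸ 1 ∸ toℕ i
      l₀-toℕ i = Fin.toℕ-fromℕ< (l₀< i)
      δ-refl' : ∀ {a b} → a ≡ b → δ R a b ≡ 1#
      δ-refl' {a} ≡.refl = δ-refl a
      solves : ∀ i l → toℕ i ℕ.+ toℕ l ≡ n ∸ 1 → l ≡ l₀ i
      solves i l eq = Fin.toℕ-injective (≡.trans (≡.sym (ℕ.m+n∸m≡n (toℕ i) (toℕ l)))
                        (≡.trans (≡.cong (_∸ toℕ i) eq) (≡.sym (l₀-toℕ i))))
      reflected : ∀ a b → a ≤ n ∸ 1 → δ R (n ∸ 1 ∸ a ℕ.+ b) (n ∸ 1) ≡ δ R a b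
      reflected a b a≤ with a ℕ.≟ b
      ... | yes ≡.refl = ≡.trans (δ-refl' (ℕ.m∸n+n≡m a≤)) (≡.sym (δ-refl a))
      ... | no a≢b = ≡.trans (δ-≢ λ eq → a≢b (≡.sym (ℕ.+-cancelˡ-≡ (n ∸ 1 ∸ a) b a (≡.trans eq (≡.sym (ℕ.m∸n+n≡m a≤))))))
                            (≡.sym (δ-≢ a≢b))

module GeneratorMatrix {c ℓ} (R : CommutativeRing c ℓ) (ι : Involution R) (m : ℕ)
  (lam μ : CommutativeRing.Carrier R) (a b c' : Vect R (suc m)) where
  open CommutativeRing R
  open Matrices R
  open Adjoint R ι
  open NegatedUnitaryBlock R ι
  open ExchangeMatrix R ι (suc m) using (J; Jᴴ≋J; J∙J≋𝟏)
  module Cλ = Circulants R ι m lam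
  module Cμ = Circulants R ι m μ
  open ≋-Reasoning

  N : ℕ
  N = suc m

  A B C U V K H D : Mat R N N
  A = circ R lam a
  B = circ R lam b
  C = circ R μ c'
  U = A ᵗ
  V = B ᵗ
  K = C ∙ J
  H = A ∙ A ᴴ ⊕ B ∙ B ᴴ
  D = C ∙ C ᴴ

  -- Gmat R ι N lam μ a b c' is definitionally hcat R (𝟏 (N ℕ.+ N)) X.
  X : Mat R (N ℕ.+ N) (N ℕ.+ N)
  X = block R (⊖ ((U ∙ C) ∙ J)) (⊖ V ᴴ) ((V ∙ C) ∙ J) (⊖ U ᴴ)

  X≋ξ : X ≋ ξ U V K
  X≋ξ = block-cong (⊖-cong (∙-assoc U C J)) ≋-refl (∙-assoc V C J) ≋-refl

  J∙𝟏∙J : J ∙ 𝟏 N ∙ J ≋ 𝟏 N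
  J∙𝟏∙J = ≋-trans (∙-congʳ {B = J} (∙-𝟏 J)) J∙J≋𝟏

  J-conjugate≋𝟏 : ∀ {M} → J ∙ M ∙ J ≋ 𝟏 N → M ≋ 𝟏 N
  J-conjugate≋𝟏 {M} JMJ≋𝟏 = begin
    M                       ≈⟨ ≋-trans (∙-𝟏 (𝟏 N ∙ M)) (𝟏-∙ M) ⟨
    𝟏 N ∙ M ∙ 𝟏 N           ≈⟨ ∙-cong (∙-congʳ {B = M} J∙J≋𝟏) J∙J≋𝟏 ⟨
    J ∙ J ∙ M ∙ (J ∙ J)     ≈⟨ solve 2 (λ j x → ((j ⊙ j) ⊙ x) ⊙ (j ⊙ j) ⊜ (j ⊙ ((j ⊙ x) ⊙ j)) ⊙ j) ≋-refl J M ⟩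
    J ∙ (J ∙ M ∙ J) ∙ J     ≈⟨ ∙-congʳ {B = J} (∙-congˡ {A = J} JMJ≋𝟏) ⟩
    J ∙ 𝟏 N ∙ J             ≈⟨ J∙𝟏∙J ⟩
    𝟏 N                     ∎
    where open MonoidSolver N

  ⊖𝟏≋-1•𝟏 : ⊖ 𝟏 N ≋ (- 1#) • 𝟏 N
  ⊖𝟏≋-1•𝟏 = mk≋ λ i j → sym (-1*x≈-x _)
    where open RingProperties ring using (-1*x≈-x)

  𝟏≋1•𝟏 : 𝟏 N ≋ 1# • 𝟏 N
  𝟏≋1•𝟏 = mk≋ λ i j → sym (*-identityˡ _)

  ≋-rhs⇔ : ∀ {M P Q : Mat R N N} → P ≋ Q → (M ≋ P) ⇔ (M ≋ Q)
  ≋-rhs⇔ P≋Q = mk⇔ (λ M≋P → ≋-trans M≋P P≋Q) (λ M≋Q → ≋-trans M≋Q (≋-sym P≋Q))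

  Θab Θc : ℕ → Carrier
  Θab j = Θ R a (conjV R ι a) j (bar lam) + Θ R b (conjV R ι b) j (bar lam)
  Θc j = Θ R c' (conjV R ι c') j (bar μ)

  module _ (λλ̄≈1 : lam * bar lam ≈ 1#) (μμ̄≈1 : μ * bar μ ≈ 1#) where
    private
      hA : Cλ.Commutes A
      hA = Cλ.Commutes-circ a
      hB : Cλ.Commutes B
      hB = Cλ.Commutes-circ b
      hC : Cμ.Commutes C
      hC = Cμ.Commutes-circ c'
      hAᴴ : Cλ.Commutes (A ᴴ)
      hAᴴ = Cλ.Unitary.Commutes-ᴴ λλ̄≈1 hA
      hBᴴ : Cλ.Commutes (B ᴴ)
      hBᴴ = Cλ.Unitary.Commutes-ᴴ λλ̄≈1 hB
      hCᴴ : Cμ.Commutes (C ᴴ)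
      hCᴴ = Cμ.Unitary.Commutes-ᴴ μμ̄≈1 hC

    UV-normal : CommutingNormal U V
    UV-normal = record
      { U-normal = ᵗ-comm {A = A} {A ᴴ} (Cλ.commutes-comm hA hAᴴ)
      ; V-normal = ᵗ-comm {A = B} {B ᴴ} (Cλ.commutes-comm hB hBᴴ)
      ; U∙V = ᵗ-comm {A = A} {B} (Cλ.commutes-comm hA hB)
      ; U∙Vᴴ = ᵗ-comm {A = A} {B ᴴ} (Cλ.commutes-comm hA hBᴴ)
      ; Uᴴ∙V = ᵗ-comm {A = A ᴴ} {B} (Cλ.commutes-comm hAᴴ hB)
      ; Uᴴ∙Vᴴ = ᵗ-comm {A = A ᴴ} {B ᴴ} (Cλ.commutes-comm hAᴴ hBᴴ)
      }

    K∙Kᴴ≋D : K ∙ K ᴴ ≋ D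
    K∙Kᴴ≋D = ≋-trans (∙-∙ᴴ C J C) (∙-congʳ {B = C ᴴ}
      (≋-trans (∙-congˡ {A = C} (≋-trans (∙-congˡ {A = J} Jᴴ≋J) J∙J≋𝟏)) (∙-𝟏 C)))

    Kᴴ∙K≋JDJ : K ᴴ ∙ K ≋ J ∙ D ∙ J
    Kᴴ∙K≋JDJ = begin
      K ᴴ ∙ K                  ≈⟨ ᴴ-∙ʳ C J (C ∙ J) ⟩
      J ᴴ ∙ (C ᴴ ∙ (C ∙ J))    ≈⟨ solve 4 (λ jᴴ cᴴ c j → jᴴ ⊙ (cᴴ ⊙ (c ⊙ j)) ⊜ (jᴴ ⊙ (cᴴ ⊙ c)) ⊙ j)
                                        ≋-refl (J ᴴ) (C ᴴ) C J ⟩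
      J ᴴ ∙ (C ᴴ ∙ C) ∙ J      ≈⟨ ∙-congʳ {B = J} (∙-cong Jᴴ≋J (≋-sym (Cμ.commutes-comm hC hCᴴ))) ⟩
      J ∙ D ∙ J                ∎
      where open MonoidSolver N

    negatedUnitary⇔ : IsNegatedUnitary X ⇔ (S U V K ≋ ⊖ 𝟏 N × D ≋ 𝟏 N)
    negatedUnitary⇔ = mk⇔ to from
      where
        to : IsNegatedUnitary X → S U V K ≋ ⊖ 𝟏 N × D ≋ 𝟏 N
        to X-nu = proj₁ S≋∧KᴴK≋𝟏 , J-conjugate≋𝟏 (≋-trans (≋-sym Kᴴ∙K≋JDJ) (proj₂ S≋∧KᴴK≋𝟏))
          where S≋∧KᴴK≋𝟏 = ξᴴ∙ξ≋-𝟏⇒ U V K UV-normal (proj₂ (IsNegatedUnitary-resp X≋ξ X-nu))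
        from : S U V K ≋ ⊖ 𝟏 N × D ≋ 𝟏 N → IsNegatedUnitary X
        from (S≋ , D≋𝟏) = IsNegatedUnitary-resp (≋-sym X≋ξ) (ξ-negatedUnitary U V K UV-normal S≋
          (≋-trans K∙Kᴴ≋D D≋𝟏) (≋-trans Kᴴ∙K≋JDJ (≋-trans (∙-congʳ {B = J} (∙-congˡ {A = J} D≋𝟏)) J∙𝟏∙J)))

    S⇔H : (S U V K ≋ ⊖ 𝟏 N) ⇔ (H ≋ ⊖ 𝟏 N)
    S⇔H = mk⇔ (λ S≋ → ≋-trans (ᵗ-cong (≋-trans (≋-sym S≋Hᵗ) S≋)) ⊖𝟏ᵗ)
              (λ H≋ → ≋-trans S≋Hᵗ (≋-trans (ᵗ-cong H≋) ⊖𝟏ᵗ))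
      where
        open CommutingNormal UV-normal using (U-normal; V-normal)
        S≋Hᵗ : S U V K ≋ H ᵗ
        S≋Hᵗ = ⊕-cong (≋-trans U-normal (≋-sym (ᵗ-∙ A (A ᴴ)))) (≋-trans V-normal (≋-sym (ᵗ-∙ B (B ᴴ))))
        ⊖𝟏ᵗ : (⊖ 𝟏 N) ᵗ ≋ ⊖ 𝟏 N
        ⊖𝟏ᵗ = ⊖-cong (𝟏ᵗ N)

    H⇔Θab : (H ≋ ⊖ 𝟏 N) ⇔ (Θab 0 ≈ - 1# × (∀ j → 1 ≤ j → j ≤ N / 2 → Θab j ≈ 0#))
    H⇔Θab = ⇔-trans (≋-rhs⇔ ⊖𝟏≋-1•𝟏) (⇔-trans (Cλ.scalar⇔firstRow (- 1#) hH Hᴴ≋H) (Cλ.firstRow⇔ {H} (- 1#) Θab row₀))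
      where
        hH : Cλ.Commutes H
        hH = Cλ.Commutes-⊕ (Cλ.Commutes-∙ hA hAᴴ) (Cλ.Commutes-∙ hB hBᴴ)
        Hᴴ≋H : H ᴴ ≋ H
        Hᴴ≋H = ≋-trans (⊕ᴴ (A ∙ A ᴴ) (B ∙ B ᴴ)) (⊕-cong (∙ᴴ-hermitian A) (∙ᴴ-hermitian B))
        row₀ : ∀ j → H Fin.zero j ≈ Θab (toℕ j)
        row₀ = λ j → +-cong (Cλ.circ∙circᴴ-row₀ a j) (Cλ.circ∙circᴴ-row₀ b j)

    D⇔Θc : (D ≋ 𝟏 N) ⇔ (Θc 0 ≈ 1# × (∀ j → 1 ≤ j → j ≤ N / 2 → Θc j ≈ 0#))
    D⇔Θc = ⇔-trans (≋-rhs⇔ 𝟏≋1•𝟏) (⇔-trans (Cμ.scalar⇔firstRow 1# (Cμ.Commutes-∙ hC hCᴴ) (∙ᴴ-hermitian C))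
                                          (Cμ.firstRow⇔ {D} 1# Θc (Cμ.circ∙circᴴ-row₀ c')))

    selfDual⇔Θ : IsHermitianSelfDual R ι (RowSpace R (Gmat R ι N lam μ a b c')) ⇔
                 ((Θab 0 ≈ - 1# × (∀ j → 1 ≤ j → j ≤ N / 2 → Θab j ≈ 0#)) ×
                  (Θc 0 ≈ 1# × (∀ j → 1 ≤ j → j ≤ N / 2 → Θc j ≈ 0#)))
    selfDual⇔Θ = ⇔-trans (SelfDualityCriterion.selfDual⇔ R ι X)
                 (⇔-trans negatedUnitary⇔ (⇔-trans S⇔H H⇔Θab ×-⇔ D⇔Θc))

theorem1 : ∀ {c ℓ} (R : CommutativeRing c ℓ) → IsFrobenius R →
    (ι : Involution R) →
    let open CommutativeRing R
        bar = Involution.bar ι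
    in (n : ℕ) → 1 ≤ n →
       (lam μ : Carrier) → lam * bar lam ≈ 1# → μ * bar μ ≈ 1# →
       (a b c' : Vect R n) →
       IsHermitianSelfDual R ι (RowSpace R (Gmat R ι n lam μ a b c'))
       ⇔
       ((Θ R a (conjV R ι a) 0 (bar lam) + Θ R b (conjV R ι b) 0 (bar lam) ≈ - 1#)
        × (∀ j → 1 ≤ j → j ≤ n / 2 →
             Θ R a (conjV R ι a) j (bar lam) + Θ R b (conjV R ι b) j (bar lam) ≈ 0#)
        × (Θ R c' (conjV R ι c') 0 (bar μ) ≈ 1#)
        × (∀ j → 1 ≤ j → j ≤ n / 2 →
             Θ R c' (conjV R ι c') j (bar μ) ≈ 0#))
theorem1 R _ ι (suc m) _ lam μ λλ̄≈1 μμ̄≈1 a b c' =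
  ⇔-trans (GeneratorMatrix.selfDual⇔Θ R ι m lam μ a b c' λλ̄≈1 μμ̄≈1)
          (mk⇔ (λ ((θ₀ , θⱼ) , (θ₀' , θⱼ')) → θ₀ , θⱼ , θ₀' , θⱼ')
               (λ (θ₀ , θⱼ , θ₀' , θⱼ') → (θ₀ , θⱼ) , (θ₀' , θⱼ')))
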